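{- Let $m$ be an odd prime and let $j\geq 0$ be an integer such that $m\,\|\,8j+1$ (i.e. $m\mid 8j+1$ but $m^2\nmid 8j+1$). Then $$b_4(m^2n+j)\equiv 0 \pmod 2$$ for every integer $n\geq 0$.
   Context: $b_4(n)$ is the number of partitions of $n$ with no part divisible by $4$, with $b_4(0)=1$; equivalently $\sum_{n\geq 0} b_4(n)q^n=\prod_{n\geq 1}\frac{1-q^{4n}}{1-q^n}$. -}

module Defs where

open import Data.Nat using (ℕ; zero; suc; _+_; _*_; _∸_; _≤?_)
open import Data.Nat.Divisibility using (_∣?_)
open import Relation.Nullary using (yes; no)

-- uptoMult d n f = Σ_{c ≥ 0, c*d ≤ n} f (n ∸ c*d), for a part size d ≥ 1,
-- computed by structural recursion on a fuel argument (fuel n suffices since d ≥ 1).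
sumMultiples : (fuel d r : ℕ) → (ℕ → ℕ) → ℕ
sumMultiples zero    d r f = f r
sumMultiples (suc k) d r f with d ≤? r
... | yes _ = f r + sumMultiples k d (r ∸ d) f
... | no  _ = f r

-- pk k n = number of partitions of n into parts from {1,…,k} none of which is
-- divisible by 4.
pk : ℕ → ℕ → ℕ
pk zero    zero    = 1
pk zero    (suc _) = 0
pk (suc k) n with 4 ∣? suc k
... | yes _ = pk k n
... | no  _ = sumMultiples n (suc k) n (pk k)

b₄ : ℕ → ℕ
b₄ n = pk n n

{-# OPTIONS --safe #-}
-- Modulo 2, ∏ (1 − q⁴ⁿ)/(1 − qⁿ) is the inverse of ∏_{4 ∤ j} (1 + qʲ), and the Jacobi triple
-- product reduced modulo 2 shows that this inverse is θ = Σ_{k ∈ ℤ} q^{2k² + k}, the sum of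
-- q^t over all triangular numbers t. So b₄(N) is odd exactly when 8N + 1 is a square; for
-- N = m²n + j the number 8N + 1 = 8m²n + (8j + 1) is divisible by m but not by m².
--
-- The identity is proved with two-variable series over 𝔽₂. The truncated triple product
-- G = ∏_{j<N} (1 + z q^{4j+3}) ∏_{j<M} (1 + z⁻¹ q^{4j+1}) satisfies G(z) = z q³ G(z q⁴) up to a
-- shift of N and M, so its zᵏ-coefficient is q^{2k²+k} times its constant term C. At z = 1 this
-- gives ∏_{j odd} (1 + qʲ) = θ C, and at z = q⁻¹ it gives ∏_{j ≡ 2 (mod 4)} (1 + qʲ)² = C, as the
-- terms q^{-2k²} cancel in pairs. All of this is compared in degrees ≤ L, with N = M = 2L + 1.
module Submission where

open import Defs
open import Data.Nat.Primality using (Prime; euclidsLemma)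
open import Data.Nat.Divisibility using (_∣_; _∣?_; ∣⇒≤; n∣m*n; m∣m*n; ∣-trans; ∣m∣n⇒∣m+n; ∣m+n∣m⇒∣n; *-pres-∣)
open import Data.Nat using (ℕ; zero; suc; _+_; _*_; _∸_; _≤_; _<_; z≤n; s≤s; _^_; _%_; _≤?_; parity)
import Data.Nat.Properties as ℕP
import Data.Nat.Tactic.RingSolver as ℕSolver
open import Data.Integer as ℤ using (ℤ; +_; -[1+_]; ∣_∣; 0ℤ; 1ℤ; -1ℤ)
  renaming (_+_ to _+ᶻ_; _-_ to _-ᶻ_; _*_ to _*ᶻ_)
import Data.Integer.Properties as ℤP
open import Data.Integer.Tactic.RingSolver using (solve-∀)
open import Data.Parity.Base using (Parity; 0ℙ; 1ℙ) renaming (_+_ to _⊕_)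
import Data.Parity.Properties as ℙP
import Algebra.Solver.Ring.Simple as RingSolver
import Algebra.Solver.Ring.AlmostCommutativeRing as ACR
open import Data.List using (List; []; _∷_; _∷ʳ_; map)
open import Data.List.Relation.Unary.All using (All; []; _∷_)
open import Data.Product using (∃-syntax; _,_; _×_)
open import Data.Sum using (_⊎_; inj₁; inj₂; [_,_])
open import Data.Empty using (⊥-elim)
open import Data.Nat.Induction using (<-rec)
open import Function using (id)
open import Relation.Binary using (Setoid)
import Relation.Binary.Reasoning.Setoid as SetoidReasoning
open import Relation.Binary.PropositionalEquality
  using (_≡_; _≢_; refl; sym; trans; cong; cong₂; subst; subst₂; module ≡-Reasoning)
open import Relation.Nullary using (¬_; yes; no)

module ℙ-Solver = RingSolver (ACR.fromCommutativeRing ℙP.+-*-commutativeRing) ℙP._≟_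
open ℙ-Solver using (solve; _:=_; _:+_)

⊕-interchange : ∀ a b c d → (a ⊕ b) ⊕ (c ⊕ d) ≡ (a ⊕ c) ⊕ (b ⊕ d)
⊕-interchange = solve 4 (λ a b c d → (a :+ b) :+ (c :+ d) := (a :+ c) :+ (b :+ d)) refl

⊕-cancelʳ : ∀ a b → (a ⊕ b) ⊕ b ≡ a
⊕-cancelʳ = solve 2 (λ a b → (a :+ b) :+ b := a) refl

⊕≡0ℙ⇒≡ : ∀ {a b} → a ⊕ b ≡ 0ℙ → a ≡ b
⊕≡0ℙ⇒≡ {a} {b} e = ℙP.+-cancelʳ-≡ b a b (trans e (sym (ℙP.p+p≡0ℙ b)))

⊕≡1ℙ⇒⊎ : ∀ a b → a ⊕ b ≡ 1ℙ → a ≡ 1ℙ ⊎ b ≡ 1ℙ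
⊕≡1ℙ⇒⊎ 1ℙ b _ = inj₁ refl
⊕≡1ℙ⇒⊎ 0ℙ b e = inj₂ e

-[1+m]-n≡-[1+m+n] : ∀ m n → -[1+ m ] -ᶻ + n ≡ -[1+ (m + n) ]
-[1+m]-n≡-[1+m+n] m zero    = cong -[1+_] (sym (ℕP.+-identityʳ m))
-[1+m]-n≡-[1+m+n] m (suc n) = cong -[1+_] (sym (ℕP.+-suc m n))

m-n≡m∸n : ∀ {m n} → n ≤ m → + m -ᶻ + n ≡ + (m ∸ n)
m-n≡m∸n {m} {n} n≤m = trans (ℤP.m-n≡m⊖n m n) (ℤP.⊖-≥ n≤m)

m-n≡-[1+n∸1+m] : ∀ {m n} → m < n → + m -ᶻ + n ≡ -[1+ (n ∸ suc m) ]
m-n≡-[1+n∸1+m] {m} {n} m<n = trans (ℤP.m-n≡m⊖n m n) (trans (ℤP.⊖-< m<n) (neg m<n))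
  where
  neg : ∀ {m n} → m < n → ℤ.- (+ (n ∸ m)) ≡ -[1+ (n ∸ suc m) ]
  neg {zero}  {suc n} _         = refl
  neg {suc m} {suc n} (s≤s m<n) = neg m<n

sub-≡+⇒≤ : ∀ {m b n} → + m -ᶻ + b ≡ + n → n ≤ m
sub-≡+⇒≤ {m} {b} eq with b ≤? m
... | yes b≤m = subst (_≤ m) (ℤP.+-injective (trans (sym (m-n≡m∸n b≤m)) eq)) (ℕP.m∸n≤m m b)
... | no b≰m with trans (sym (m-n≡-[1+n∸1+m] (ℕP.≰⇒> b≰m))) eq
...   | ()

sub-≡+⇒< : ∀ {m b n} → 0 < b → + m -ᶻ + b ≡ + n → n < m
sub-≡+⇒< {m} {b} 0<b eq with b ≤? m
... | yes b≤m = subst (_< m) (ℤP.+-injective (trans (sym (m-n≡m∸n b≤m)) eq)) (ℕP.∸-monoʳ-< 0<b b≤m)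
... | no b≰m with trans (sym (m-n≡-[1+n∸1+m] (ℕP.≰⇒> b≰m))) eq
...   | ()

Series : Set
Series = ℤ → Parity

-- Records rather than pointwise function types, so that the series are inferable from the relation.
infix 4 _≈_ _≈[_]_

record _≈_ (f g : Series) : Set where
  constructor mk≈
  field coeff-≈ : ∀ x → f x ≡ g x
open _≈_ public

record _≈[_]_ (f : Series) (L : ℕ) (g : Series) : Set where
  constructor mk≈[]
  field coeff-≈[] : ∀ n → n ≤ L → f (+ n) ≡ g (+ n)
open _≈[_]_ public

record IsPowerSeries (f : Series) : Set where
  constructor mkPowerSeries
  field coeff-neg : ∀ n → f -[1+ n ] ≡ 0ℙ
open IsPowerSeries public

≈-refl : ∀ {f} → f ≈ f
≈-refl = mk≈ λ _ → refl

≈-sym : ∀ {f g} → f ≈ g → g ≈ f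
≈-sym f≈g = mk≈ λ x → sym (coeff-≈ f≈g x)

≈-trans : ∀ {f g h} → f ≈ g → g ≈ h → f ≈ h
≈-trans f≈g g≈h = mk≈ λ x → trans (coeff-≈ f≈g x) (coeff-≈ g≈h x)

≈-setoid : Setoid _ _
≈-setoid = record
  { _≈_ = _≈_ ; isEquivalence = record { refl = ≈-refl ; sym = ≈-sym ; trans = ≈-trans } }

module ≈-Reasoning = SetoidReasoning ≈-setoid

≈⇒≈[] : ∀ {f g L} → f ≈ g → f ≈[ L ] g
≈⇒≈[] f≈g = mk≈[] λ n _ → coeff-≈ f≈g (+ n)

≈[]-refl : ∀ {f L} → f ≈[ L ] f
≈[]-refl = mk≈[] λ _ _ → refl

≈[]-sym : ∀ {f g L} → f ≈[ L ] g → g ≈[ L ] f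
≈[]-sym f≈g = mk≈[] λ n n≤L → sym (coeff-≈[] f≈g n n≤L)

≈[]-trans : ∀ {f g h L} → f ≈[ L ] g → g ≈[ L ] h → f ≈[ L ] h
≈[]-trans f≈g g≈h = mk≈[] λ n n≤L → trans (coeff-≈[] f≈g n n≤L) (coeff-≈[] g≈h n n≤L)

≈[]-setoid : ℕ → Setoid _ _
≈[]-setoid L = record
  { _≈_ = _≈[ L ]_ ; isEquivalence = record { refl = ≈[]-refl ; sym = ≈[]-sym ; trans = ≈[]-trans } }

module ≈[]-Reasoning (L : ℕ) = SetoidReasoning (≈[]-setoid L)

one : Series
one (+ zero) = 1ℙ
one _        = 0ℙ

one-isPowerSeries : IsPowerSeries one
one-isPowerSeries = mkPowerSeries λ _ → refl

coeff-sub-≥ : ∀ (f : Series) {n b} → b ≤ n → f (+ n -ᶻ + b) ≡ f (+ (n ∸ b))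
coeff-sub-≥ f b≤n = cong f (m-n≡m∸n b≤n)

coeff-sub-< : ∀ {f} → IsPowerSeries f → ∀ {n b} → n < b → f (+ n -ᶻ + b) ≡ 0ℙ
coeff-sub-< {f} pf n<b = trans (cong f (m-n≡-[1+n∸1+m] n<b)) (coeff-neg pf _)

coeff-sub-neg : ∀ {f} → IsPowerSeries f → ∀ m b → f (-[1+ m ] -ᶻ + b) ≡ 0ℙ
coeff-sub-neg {f} pf m b = trans (cong f (-[1+m]-n≡-[1+m+n] m b)) (coeff-neg pf _)

coeff-sub-≈[] : ∀ {f g L} → IsPowerSeries f → IsPowerSeries g → f ≈[ L ] g →
                ∀ n b → n ≤ L → f (+ n -ᶻ + b) ≡ g (+ n -ᶻ + b)
coeff-sub-≈[] {f} {g} pf pg f≈g n b n≤L with b ≤? n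
... | yes b≤n = begin
  f (+ n -ᶻ + b)  ≡⟨ coeff-sub-≥ f b≤n ⟩
  f (+ (n ∸ b))   ≡⟨ coeff-≈[] f≈g (n ∸ b) (ℕP.≤-trans (ℕP.m∸n≤m n b) n≤L) ⟩
  g (+ (n ∸ b))   ≡⟨ coeff-sub-≥ g b≤n ⟨
  g (+ n -ᶻ + b)  ∎
  where open ≡-Reasoning
... | no b≰n = trans (coeff-sub-< pf (ℕP.≰⇒> b≰n)) (sym (coeff-sub-< pg (ℕP.≰⇒> b≰n)))

infixr 5 1+q^_·_

1+q^_·_ : ℕ → Series → Series
(1+q^ b · f) x = f x ⊕ f (x -ᶻ + b)

1+q^-cong : ∀ b {f g} → f ≈ g → 1+q^ b · f ≈ 1+q^ b · g
1+q^-cong b f≈g = mk≈ λ x → cong₂ _⊕_ (coeff-≈ f≈g x) (coeff-≈ f≈g (x -ᶻ + b))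

1+q^-isPowerSeries : ∀ b {f} → IsPowerSeries f → IsPowerSeries (1+q^ b · f)
1+q^-isPowerSeries b pf = mkPowerSeries λ m → cong₂ _⊕_ (coeff-neg pf m) (coeff-sub-neg pf m b)

1+q^-comm : ∀ a b f → 1+q^ a · 1+q^ b · f ≈ 1+q^ b · 1+q^ a · f
1+q^-comm a b f = mk≈ λ x → begin
  (f x ⊕ f (x -ᶻ + b)) ⊕ (f (x -ᶻ + a) ⊕ f ((x -ᶻ + a) -ᶻ + b))
    ≡⟨ cong (λ y → (f x ⊕ f (x -ᶻ + b)) ⊕ (f (x -ᶻ + a) ⊕ f y)) (sub-comm x (+ a) (+ b)) ⟩
  (f x ⊕ f (x -ᶻ + b)) ⊕ (f (x -ᶻ + a) ⊕ f ((x -ᶻ + b) -ᶻ + a))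
    ≡⟨ ⊕-interchange (f x) (f (x -ᶻ + b)) (f (x -ᶻ + a)) (f ((x -ᶻ + b) -ᶻ + a)) ⟩
  (f x ⊕ f (x -ᶻ + a)) ⊕ (f (x -ᶻ + b) ⊕ f ((x -ᶻ + b) -ᶻ + a)) ∎
  where
  open ≡-Reasoning
  sub-comm : ∀ x a b → (x -ᶻ a) -ᶻ b ≡ (x -ᶻ b) -ᶻ a
  sub-comm = solve-∀

1+q^-square : ∀ b f → 1+q^ b · 1+q^ b · f ≈ 1+q^ (b * 2) · f
1+q^-square b f = mk≈ λ x → begin
  (f x ⊕ f (x -ᶻ + b)) ⊕ (f (x -ᶻ + b) ⊕ f ((x -ᶻ + b) -ᶻ + b))
    ≡⟨ frob (f x) (f (x -ᶻ + b)) (f ((x -ᶻ + b) -ᶻ + b)) ⟩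
  f x ⊕ f ((x -ᶻ + b) -ᶻ + b)
    ≡⟨ cong (λ y → f x ⊕ f y) (trans (sub-twice x (+ b)) (cong (x -ᶻ_) (sym (ℤP.pos-* b 2)))) ⟩
  f x ⊕ f (x -ᶻ + (b * 2)) ∎
  where
  open ≡-Reasoning
  frob : ∀ a b c → (a ⊕ b) ⊕ (b ⊕ c) ≡ a ⊕ c
  frob = solve 3 (λ a b c → (a :+ b) :+ (b :+ c) := a :+ c) refl
  sub-twice : ∀ x y → (x -ᶻ y) -ᶻ y ≡ x -ᶻ y *ᶻ + 2
  sub-twice = solve-∀

1+q^-high : ∀ {b f L} → IsPowerSeries f → L < b → 1+q^ b · f ≈[ L ] f
1+q^-high {b} {f} pf L<b = mk≈[] λ n n≤L →
  trans (cong (f (+ n) ⊕_) (coeff-sub-< pf (ℕP.≤-<-trans n≤L L<b))) (ℙP.+-identityʳ _)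

-- 1 + q^b is invertible on power series: solve for the coefficients in increasing degree.
1+q^-cancel : ∀ {b f g L} → IsPowerSeries f → IsPowerSeries g → 0 < b →
              1+q^ b · f ≈[ L ] 1+q^ b · g → f ≈[ L ] g
1+q^-cancel {b} {f} {g} {L} pf pg 0<b eq = mk≈[] (<-rec (λ n → n ≤ L → f (+ n) ≡ g (+ n)) step)
  where
  step : ∀ n → (∀ {m} → m < n → m ≤ L → f (+ m) ≡ g (+ m)) → n ≤ L → f (+ n) ≡ g (+ n)
  step n rec n≤L = begin
    f (+ n)                                ≡⟨ ⊕-cancelʳ (f (+ n)) (f (+ n -ᶻ + b)) ⟨
    (f (+ n) ⊕ f (+ n -ᶻ + b)) ⊕ f (+ n -ᶻ + b)
      ≡⟨ cong₂ _⊕_ (coeff-≈[] eq n n≤L) earlier ⟩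
    (g (+ n) ⊕ g (+ n -ᶻ + b)) ⊕ g (+ n -ᶻ + b) ≡⟨ ⊕-cancelʳ (g (+ n)) (g (+ n -ᶻ + b)) ⟩
    g (+ n)                                ∎
    where
    open ≡-Reasoning
    earlier : f (+ n -ᶻ + b) ≡ g (+ n -ᶻ + b)
    earlier with b ≤? n
    ... | yes b≤n = trans (coeff-sub-≥ f b≤n)
                    (trans (rec (ℕP.∸-monoʳ-< 0<b b≤n) (ℕP.≤-trans (ℕP.m∸n≤m n b) n≤L))
                           (sym (coeff-sub-≥ g b≤n)))
    ... | no b≰n = trans (coeff-sub-< pf (ℕP.≰⇒> b≰n)) (sym (coeff-sub-< pg (ℕP.≰⇒> b≰n)))

infixr 5 ∏1+q^_·_

∏1+q^_·_ : List ℕ → Series → Series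
∏1+q^ []      · f = f
∏1+q^ (b ∷ l) · f = 1+q^ b · ∏1+q^ l · f

∏-cong : ∀ l {f g} → f ≈ g → ∏1+q^ l · f ≈ ∏1+q^ l · g
∏-cong []      f≈g = f≈g
∏-cong (b ∷ l) f≈g = 1+q^-cong b (∏-cong l f≈g)

∏-isPowerSeries : ∀ l {f} → IsPowerSeries f → IsPowerSeries (∏1+q^ l · f)
∏-isPowerSeries []      pf = pf
∏-isPowerSeries (b ∷ l) pf = 1+q^-isPowerSeries b (∏-isPowerSeries l pf)

1+q^-∏ : ∀ b l f → 1+q^ b · ∏1+q^ l · f ≈ ∏1+q^ l · 1+q^ b · f
1+q^-∏ b []      f = ≈-refl
1+q^-∏ b (c ∷ l) f = ≈-trans (1+q^-comm b c (∏1+q^ l · f)) (1+q^-cong c (1+q^-∏ b l f))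

∏-square : ∀ l f → ∏1+q^ l · ∏1+q^ l · f ≈ ∏1+q^ map (_* 2) l · f
∏-square []      f = ≈-refl
∏-square (b ∷ l) f = begin
  1+q^ b · ∏1+q^ l · 1+q^ b · ∏1+q^ l · f  ≈⟨ 1+q^-cong b (1+q^-∏ b l (∏1+q^ l · f)) ⟨
  1+q^ b · 1+q^ b · ∏1+q^ l · ∏1+q^ l · f  ≈⟨ 1+q^-square b (∏1+q^ l · ∏1+q^ l · f) ⟩
  1+q^ (b * 2) · ∏1+q^ l · ∏1+q^ l · f     ≈⟨ 1+q^-cong (b * 2) (∏-square l f) ⟩
  1+q^ (b * 2) · ∏1+q^ map (_* 2) l · f    ∎
  where open ≈-Reasoning

∏-cancel : ∀ l {f g L} → All (0 <_) l → IsPowerSeries f → IsPowerSeries g →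
           ∏1+q^ l · f ≈[ L ] ∏1+q^ l · g → f ≈[ L ] g
∏-cancel []      []           pf pg eq = eq
∏-cancel (b ∷ l) (0<b ∷ 0<l) pf pg eq =
  ∏-cancel l 0<l pf pg (1+q^-cancel (∏-isPowerSeries l pf) (∏-isPowerSeries l pg) 0<b eq)

∏-comm : ∀ l l′ f → ∏1+q^ l · ∏1+q^ l′ · f ≈ ∏1+q^ l′ · ∏1+q^ l · f
∏-comm []      l′ f = ≈-refl
∏-comm (b ∷ l) l′ f = ≈-trans (1+q^-cong b (∏-comm l l′ f)) (1+q^-∏ b l′ (∏1+q^ l · f))

progression : ℕ → ℕ → List ℕ
progression r zero    = []
progression r (suc N) = (r + N * 4) ∷ progression r N

progression-positive : ∀ {r} → 0 < r → ∀ N → All (0 <_) (progression r N)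
progression-positive 0<r zero    = []
progression-positive 0<r (suc N) = ℕP.<-≤-trans 0<r (ℕP.m≤m+n _ _) ∷ progression-positive 0<r N

∏-progression-high : ∀ {r L N N′ f} → IsPowerSeries f → L < r + N * 4 → N ≤ N′ →
                     ∏1+q^ progression r N′ · f ≈[ L ] ∏1+q^ progression r N · f
∏-progression-high {r} {L} {N} {N′} {f} pf L<r+4N N≤N′ =
  subst (λ N″ → ∏1+q^ progression r N″ · f ≈[ L ] ∏1+q^ progression r N · f)
        (ℕP.m∸n+n≡m N≤N′) (drop (N′ ∸ N))
  where
  drop : ∀ d → ∏1+q^ progression r (d + N) · f ≈[ L ] ∏1+q^ progression r N · f
  drop zero    = ≈[]-refl
  drop (suc d) = ≈[]-trans
    (1+q^-high (∏-isPowerSeries (progression r (d + N)) pf)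
      (ℕP.<-≤-trans L<r+4N (ℕP.+-monoʳ-≤ r (ℕP.*-monoˡ-≤ 4 (ℕP.m≤n+m N d)))))
    (drop d)

∏-doubled-odd : ∀ N f → ∏1+q^ map (_* 2) (progression 3 N) · ∏1+q^ map (_* 2) (progression 1 N) · f
                      ≈ ∏1+q^ progression 2 (N * 2) · f
∏-doubled-odd zero    f = ≈-refl
∏-doubled-odd (suc N) f = begin
  1+q^ ((3 + N * 4) * 2) · D₃· 1+q^ ((1 + N * 4) * 2) · D₁· f
    ≈⟨ 1+q^-cong _ (1+q^-∏ ((1 + N * 4) * 2) (map (_* 2) (progression 3 N)) (D₁· f)) ⟨
  1+q^ ((3 + N * 4) * 2) · 1+q^ ((1 + N * 4) * 2) · D₃· D₁· f
    ≡⟨ cong₂ (λ a b → 1+q^ a · 1+q^ b · D₃· D₁· f) (d₃ N) (d₁ N) ⟩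
  1+q^ (2 + suc (N * 2) * 4) · 1+q^ (2 + N * 2 * 4) · D₃· D₁· f
    ≈⟨ 1+q^-cong _ (1+q^-cong _ (∏-doubled-odd N f)) ⟩
  ∏1+q^ progression 2 (suc N * 2) · f ∎
  where
  open ≈-Reasoning
  infixr 5 D₁·_ D₃·_
  D₁·_ D₃·_ : Series → Series
  D₁· g = ∏1+q^ map (_* 2) (progression 1 N) · g
  D₃· g = ∏1+q^ map (_* 2) (progression 3 N) · g
  d₃ : ∀ N → (3 + N * 4) * 2 ≡ 2 + suc (N * 2) * 4
  d₃ = ℕSolver.solve-∀
  d₁ : ∀ N → (1 + N * 4) * 2 ≡ 2 + N * 2 * 4
  d₁ = ℕSolver.solve-∀

∏-odd-square : ∀ N f → ∏1+q^ progression 3 N · ∏1+q^ progression 1 N · ∏1+q^ progression 3 N · ∏1+q^ progression 1 N · f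
                     ≈ ∏1+q^ progression 2 (N * 2) · f
∏-odd-square N f = begin
  P₃· P₁· P₃· P₁· f         ≈⟨ ∏-cong (progression 3 N) (∏-comm (progression 1 N) (progression 3 N) (P₁· f)) ⟩
  P₃· P₃· P₁· P₁· f         ≈⟨ ∏-square (progression 3 N) (P₁· P₁· f) ⟩
  ∏1+q^ map (_* 2) (progression 3 N) · P₁· P₁· f
    ≈⟨ ∏-cong (map (_* 2) (progression 3 N)) (∏-square (progression 1 N) f) ⟩
  ∏1+q^ map (_* 2) (progression 3 N) · ∏1+q^ map (_* 2) (progression 1 N) · f
    ≈⟨ ∏-doubled-odd N f ⟩
  ∏1+q^ progression 2 (N * 2) · f ∎
  where
  open ≈-Reasoning
  infixr 5 P₁·_ P₃·_
  P₁·_ P₃·_ : Series → Series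
  P₁· g = ∏1+q^ progression 1 N · g
  P₃· g = ∏1+q^ progression 3 N · g

infixr 6 symSum
symSum : ℕ → (ℤ → Parity) → Parity
symSum zero    g = g (+ 0)
symSum (suc R) g = symSum R g ⊕ (g (+ suc R) ⊕ g -[1+ R ])

syntax symSum R (λ k → e) = Σ[∣ k ∣≤ R ] e

VanishesBeyond : ℕ → (ℤ → Parity) → Set
VanishesBeyond r g = ∀ k → r < ∣ k ∣ → g k ≡ 0ℙ

symSum-congᴿ : ∀ R {g h} → (∀ k → ∣ k ∣ ≤ R → g k ≡ h k) → symSum R g ≡ symSum R h
symSum-congᴿ zero    eq = eq (+ 0) z≤n
symSum-congᴿ (suc R) eq =
  cong₂ _⊕_ (symSum-congᴿ R λ k ∣k∣≤R → eq k (ℕP.m≤n⇒m≤1+n ∣k∣≤R))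
            (cong₂ _⊕_ (eq (+ suc R) ℕP.≤-refl) (eq -[1+ R ] ℕP.≤-refl))

symSum-cong : ∀ R {g h} → (∀ k → g k ≡ h k) → symSum R g ≡ symSum R h
symSum-cong R eq = symSum-congᴿ R λ k _ → eq k

symSum-zero : ∀ R {g} → (∀ k → g k ≡ 0ℙ) → symSum R g ≡ 0ℙ
symSum-zero zero    g≡0 = g≡0 (+ 0)
symSum-zero (suc R) g≡0
  rewrite symSum-zero R g≡0 | g≡0 (+ suc R) | g≡0 -[1+ R ] = refl

symSum-⊕ : ∀ R g h → Σ[∣ k ∣≤ R ] (g k ⊕ h k) ≡ symSum R g ⊕ symSum R h
symSum-⊕ zero    g h = refl
symSum-⊕ (suc R) g h rewrite symSum-⊕ R g h =
  shuffle (symSum R g) (symSum R h) (g (+ suc R)) (h (+ suc R)) (g -[1+ R ]) (h -[1+ R ])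
  where
  shuffle : ∀ A B a b c d → (A ⊕ B) ⊕ ((a ⊕ b) ⊕ (c ⊕ d)) ≡ (A ⊕ (a ⊕ c)) ⊕ (B ⊕ (b ⊕ d))
  shuffle = solve 6 (λ A B a b c d → (A :+ B) :+ ((a :+ b) :+ (c :+ d))
                                    := (A :+ (a :+ c)) :+ (B :+ (b :+ d))) refl

symSum-vanishing : ∀ {r R g} → VanishesBeyond r g → r ≤ R → symSum R g ≡ symSum r g
symSum-vanishing {r} {R} {g} v r≤R =
  subst (λ R → symSum R g ≡ symSum r g) (ℕP.m∸n+n≡m r≤R) (extend (R ∸ r))
  where
  extend : ∀ d → symSum (d + r) g ≡ symSum r g
  extend zero = refl
  extend (suc d) rewrite v (+ suc (d + r)) (s≤s (ℕP.m≤n+m r d))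
                       | v -[1+ (d + r) ] (s≤s (ℕP.m≤n+m r d)) =
    trans (ℙP.+-identityʳ _) (extend d)

symSum-even : ∀ R g → (∀ n → g (+ suc n) ≡ g -[1+ n ]) → symSum R g ≡ g (+ 0)
symSum-even zero    g even = refl
symSum-even (suc R) g even rewrite even R
  | ℙP.p+p≡0ℙ (g -[1+ R ]) | ℙP.+-identityʳ (symSum R g) = symSum-even R g even

symSum≡1ℙ⇒∃ : ∀ R g → symSum R g ≡ 1ℙ → ∃[ k ] g k ≡ 1ℙ
symSum≡1ℙ⇒∃ zero    g eq = + 0 , eq
symSum≡1ℙ⇒∃ (suc R) g eq with ⊕≡1ℙ⇒⊎ _ _ eq
... | inj₁ eq′ = symSum≡1ℙ⇒∃ R g eq′
... | inj₂ eq′ with ⊕≡1ℙ⇒⊎ _ _ eq′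
...   | inj₁ eq″ = + suc R , eq″
...   | inj₂ eq″ = -[1+ R ] , eq″

symSum-telescope : ∀ R g → (Σ[∣ k ∣≤ R ] g (k -ᶻ 1ℤ)) ⊕ symSum R g ≡ g -[1+ R ] ⊕ g (+ R)
symSum-telescope zero    g = refl
symSum-telescope (suc R) g
  rewrite -[1+m]-n≡-[1+m+n] R 1 | ℕP.+-comm R 1 = begin
    (S′ ⊕ (g (+ R) ⊕ g -[1+ suc R ])) ⊕ (S ⊕ (g (+ suc R) ⊕ g -[1+ R ]))
      ≡⟨ regroup S′ S (g (+ R)) (g -[1+ suc R ]) (g (+ suc R)) (g -[1+ R ]) ⟩
    (S′ ⊕ S) ⊕ ((g (+ R) ⊕ g (+ suc R)) ⊕ (g -[1+ suc R ] ⊕ g -[1+ R ]))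
      ≡⟨ cong (_⊕ ((g (+ R) ⊕ g (+ suc R)) ⊕ (g -[1+ suc R ] ⊕ g -[1+ R ]))) (symSum-telescope R g) ⟩
    (g -[1+ R ] ⊕ g (+ R)) ⊕ ((g (+ R) ⊕ g (+ suc R)) ⊕ (g -[1+ suc R ] ⊕ g -[1+ R ]))
      ≡⟨ collapse (g -[1+ R ]) (g (+ R)) (g (+ suc R)) (g -[1+ suc R ]) ⟩
    g -[1+ suc R ] ⊕ g (+ suc R) ∎
  where
  open ≡-Reasoning
  S′ = Σ[∣ k ∣≤ R ] g (k -ᶻ 1ℤ)
  S  = symSum R g
  regroup : ∀ A B x y z u → (A ⊕ (x ⊕ y)) ⊕ (B ⊕ (z ⊕ u)) ≡ (A ⊕ B) ⊕ ((x ⊕ z) ⊕ (y ⊕ u))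
  regroup = solve 6 (λ A B x y z u → (A :+ (x :+ y)) :+ (B :+ (z :+ u))
                                    := (A :+ B) :+ ((x :+ z) :+ (y :+ u))) refl
  collapse : ∀ a b c d → (a ⊕ b) ⊕ ((b ⊕ c) ⊕ (d ⊕ a)) ≡ d ⊕ c
  collapse = solve 4 (λ a b c d → (a :+ b) :+ ((b :+ c) :+ (d :+ a)) := d :+ c) refl

private
  vanishes-shift : ∀ {r g} c → ∣ c ∣ ≡ 1 → VanishesBeyond r g → VanishesBeyond (suc r) (λ k → g (k -ᶻ c))
  vanishes-shift {r} c ∣c∣≡1 v k r+1<∣k∣ = v (k -ᶻ c) (ℕP.≤-pred (ℕP.≤-trans r+1<∣k∣ triangle))
    where
    back : ∀ k c → (k -ᶻ c) +ᶻ c ≡ k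
    back = solve-∀
    triangle : ∣ k ∣ ≤ suc ∣ k -ᶻ c ∣
    triangle = subst₂ _≤_ (cong ∣_∣ (back k c)) (trans (cong (λ n → ∣ k -ᶻ c ∣ + n) ∣c∣≡1) (ℕP.+-comm _ 1))
                      (ℤP.∣i+j∣≤∣i∣+∣j∣ (k -ᶻ c) c)

symSum-shiftᴸ : ∀ {r R g} → VanishesBeyond r g → r < R → Σ[∣ k ∣≤ R ] g (k -ᶻ 1ℤ) ≡ symSum r g
symSum-shiftᴸ {r} {R} {g} v r<R = begin
  Σ[∣ k ∣≤ R ] g (k -ᶻ 1ℤ)      ≡⟨ symSum-vanishing (vanishes-shift 1ℤ refl v) r<R ⟩
  Σ[∣ k ∣≤ suc r ] g (k -ᶻ 1ℤ)  ≡⟨ ⊕≡0ℙ⇒≡ boundary ⟩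
  symSum (suc r) g              ≡⟨ symSum-vanishing v (ℕP.n≤1+n r) ⟩
  symSum r g                    ∎
  where
  open ≡-Reasoning
  boundary : (Σ[∣ k ∣≤ suc r ] g (k -ᶻ 1ℤ)) ⊕ symSum (suc r) g ≡ 0ℙ
  boundary = trans (symSum-telescope (suc r) g)
    (cong₂ _⊕_ (v -[1+ suc r ] (s≤s (ℕP.n≤1+n r))) (v (+ suc r) ℕP.≤-refl))

symSum-shiftᴿ : ∀ {r R g} → VanishesBeyond r g → r < R → Σ[∣ k ∣≤ R ] g (k +ᶻ 1ℤ) ≡ symSum r g
symSum-shiftᴿ {r} {R} {g} v r<R = begin
  Σ[∣ k ∣≤ R ] g (k +ᶻ 1ℤ)                   ≡⟨ symSum-vanishing v′ r<R ⟩
  Σ[∣ k ∣≤ suc r ] g (k +ᶻ 1ℤ)               ≡⟨ symSum-shiftᴸ v′ (s≤s r<R) ⟨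
  Σ[∣ k ∣≤ suc R ] g ((k -ᶻ 1ℤ) +ᶻ 1ℤ)       ≡⟨ symSum-cong (suc R) (λ k → cong g (back k)) ⟩
  symSum (suc R) g                           ≡⟨ symSum-vanishing v (ℕP.≤-trans (ℕP.n≤1+n r) (s≤s (ℕP.<⇒≤ r<R))) ⟩
  symSum r g                                 ∎
  where
  open ≡-Reasoning
  back : ∀ k → (k -ᶻ 1ℤ) +ᶻ 1ℤ ≡ k
  back = solve-∀
  v′ : VanishesBeyond (suc r) (λ k → g (k +ᶻ 1ℤ))
  v′ = vanishes-shift -1ℤ refl v

symSum-shift : ∀ {a r R g} → a ≡ 1ℤ ⊎ a ≡ -1ℤ → VanishesBeyond r g → r < R →
               Σ[∣ k ∣≤ R ] g (k -ᶻ a) ≡ symSum r g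
symSum-shift (inj₁ refl) = symSum-shiftᴸ
symSum-shift (inj₂ refl) = symSum-shiftᴿ

-- As k runs over ℤ, 2k² + k runs over the triangular numbers, each taken once.
tri : ℤ → ℕ
tri (+ n)      = n * (1 + 2 * n)
tri -[1+ m ]   = suc m * (1 + 2 * m)

+tri : ∀ k → + tri k ≡ k +ᶻ + 2 *ᶻ (k *ᶻ k)
+tri (+ n) = begin
  + (n * (1 + 2 * n))             ≡⟨ ℤP.pos-* n (1 + 2 * n) ⟩
  + n *ᶻ + (1 + 2 * n)            ≡⟨ cong (λ x → + n *ᶻ (+ 1 +ᶻ x)) (ℤP.pos-* 2 n) ⟩
  + n *ᶻ (+ 1 +ᶻ + 2 *ᶻ + n)      ≡⟨ expand (+ n) ⟩
  + n +ᶻ + 2 *ᶻ (+ n *ᶻ + n)      ∎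
  where
  open ≡-Reasoning
  expand : ∀ x → x *ᶻ (+ 1 +ᶻ + 2 *ᶻ x) ≡ x +ᶻ + 2 *ᶻ (x *ᶻ x)
  expand = solve-∀
+tri -[1+ m ] = begin
  + (suc m * (1 + 2 * m))                     ≡⟨ ℤP.pos-* (suc m) (1 + 2 * m) ⟩
  + suc m *ᶻ + (1 + 2 * m)                    ≡⟨ cong (λ x → + suc m *ᶻ (+ 1 +ᶻ x)) (ℤP.pos-* 2 m) ⟩
  + suc m *ᶻ (+ 1 +ᶻ + 2 *ᶻ + m)              ≡⟨ cong (λ x → + suc m *ᶻ (+ 1 +ᶻ + 2 *ᶻ x)) m≡1+m-1 ⟩
  + suc m *ᶻ (+ 1 +ᶻ + 2 *ᶻ (+ suc m -ᶻ + 1)) ≡⟨ negate (+ suc m) ⟩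
  ℤ.- + suc m +ᶻ + 2 *ᶻ (ℤ.- + suc m *ᶻ ℤ.- + suc m) ∎
  where
  open ≡-Reasoning
  m≡1+m-1 : + m ≡ + suc m -ᶻ + 1
  m≡1+m-1 = sym (m-n≡m∸n (s≤s z≤n))
  negate : ∀ x → x *ᶻ (+ 1 +ᶻ + 2 *ᶻ (x -ᶻ + 1)) ≡ ℤ.- x +ᶻ + 2 *ᶻ (ℤ.- x *ᶻ ℤ.- x)
  negate = solve-∀

∣k∣≤tri : ∀ k → ∣ k ∣ ≤ tri k
∣k∣≤tri (+ n)    = ℕP.m≤m*n n (1 + 2 * n)
∣k∣≤tri -[1+ m ] = ℕP.m≤m*n (suc m) (1 + 2 * m)

infixr 5 θ·_

-- Multiplication by θ = Σ_{k ∈ ℤ} q^{tri k}; only |k| ≤ |w| can contribute to the coefficient of q^w.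
θ·_ : Series → Series
(θ· f) w = Σ[∣ k ∣≤ ∣ w ∣ ] f (w -ᶻ + tri k)

θ-coeff : ∀ {f} → IsPowerSeries f → ∀ R x → (∀ n → x ≡ + n → n ≤ R) →
          Σ[∣ k ∣≤ R ] f (x -ᶻ + tri k) ≡ (θ· f) x
θ-coeff {f} pf R (+ n) bound = symSum-vanishing beyond (bound n refl)
  where
  beyond : VanishesBeyond n (λ k → f (+ n -ᶻ + tri k))
  beyond k n<∣k∣ = coeff-sub-< pf (ℕP.<-≤-trans n<∣k∣ (∣k∣≤tri k))
θ-coeff {f} pf R -[1+ m ] _ =
  trans (symSum-zero R λ k → coeff-sub-neg pf m (tri k)) (sym (symSum-zero (suc m) λ k → coeff-sub-neg pf m (tri k)))

θ-isPowerSeries : ∀ {f} → IsPowerSeries f → IsPowerSeries (θ· f)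
θ-isPowerSeries pf = mkPowerSeries λ m → symSum-zero (suc m) λ k → coeff-sub-neg pf m (tri k)

θ-cong : ∀ {f g} → f ≈ g → θ· f ≈ θ· g
θ-cong f≈g = mk≈ λ w → symSum-cong ∣ w ∣ λ k → coeff-≈ f≈g (w -ᶻ + tri k)

θ-cong-≈[] : ∀ {f g L} → IsPowerSeries f → IsPowerSeries g → f ≈[ L ] g → θ· f ≈[ L ] θ· g
θ-cong-≈[] pf pg f≈g = mk≈[] λ n n≤L → symSum-cong n λ k → coeff-sub-≈[] pf pg f≈g n (tri k) n≤L

θ-1+q^ : ∀ b {f} → IsPowerSeries f → θ· 1+q^ b · f ≈ 1+q^ b · θ· f
θ-1+q^ b {f} pf = mk≈ λ w → begin
  Σ[∣ k ∣≤ ∣ w ∣ ] (f (w -ᶻ + tri k) ⊕ f ((w -ᶻ + tri k) -ᶻ + b))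
    ≡⟨ symSum-⊕ ∣ w ∣ (λ k → f (w -ᶻ + tri k)) (λ k → f ((w -ᶻ + tri k) -ᶻ + b)) ⟩
  (θ· f) w ⊕ (Σ[∣ k ∣≤ ∣ w ∣ ] f ((w -ᶻ + tri k) -ᶻ + b))
    ≡⟨ cong ((θ· f) w ⊕_) (symSum-cong ∣ w ∣ λ k → cong f (sub-comm w (+ tri k) (+ b))) ⟩
  (θ· f) w ⊕ (Σ[∣ k ∣≤ ∣ w ∣ ] f ((w -ᶻ + b) -ᶻ + tri k))
    ≡⟨ cong ((θ· f) w ⊕_) (θ-coeff pf ∣ w ∣ (w -ᶻ + b) (bound w)) ⟩
  (θ· f) w ⊕ (θ· f) (w -ᶻ + b) ∎
  where
  open ≡-Reasoning
  sub-comm : ∀ x a b → (x -ᶻ a) -ᶻ b ≡ (x -ᶻ b) -ᶻ a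
  sub-comm = solve-∀
  bound : ∀ w n → w -ᶻ + b ≡ + n → n ≤ ∣ w ∣
  bound (+ m)    n eq = sub-≡+⇒≤ {m} {b} eq
  bound -[1+ m ] n eq with trans (sym (-[1+m]-n≡-[1+m+n] m b)) eq
  ... | ()

θ-∏ : ∀ l {f} → IsPowerSeries f → θ· ∏1+q^ l · f ≈ ∏1+q^ l · θ· f
θ-∏ []      pf = ≈-refl
θ-∏ (b ∷ l) pf = ≈-trans (θ-1+q^ b (∏-isPowerSeries l pf)) (1+q^-cong b (θ-∏ l pf))

θ·one≡1ℙ⇒triangular : ∀ n → (θ· one) (+ n) ≡ 1ℙ → ∃[ k ] n ≡ tri k
θ·one≡1ℙ⇒triangular n eq with symSum≡1ℙ⇒∃ n _ eq
... | k , one≡1ℙ = k , ℤP.+-injective (ℤP.i-j≡0⇒i≡j (+ n) (+ tri k) (one≡1ℙ⇒≡0 one≡1ℙ))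
  where
  one≡1ℙ⇒≡0 : ∀ {x} → one x ≡ 1ℙ → x ≡ + 0
  one≡1ℙ⇒≡0 {+ zero} _ = refl

-- Series in z and q: F k w is the coefficient of zᵏ qʷ.
Series₂ : Set
Series₂ = ℤ → ℤ → Parity

infix 4 _≈₂_

record _≈₂_ (F G : Series₂) : Set where
  constructor mk≈₂
  field coeff-≈₂ : ∀ k w → F k w ≡ G k w
open _≈₂_ public

≈₂-refl : ∀ {F} → F ≈₂ F
≈₂-refl = mk≈₂ λ _ _ → refl

≈₂-sym : ∀ {F G} → F ≈₂ G → G ≈₂ F
≈₂-sym F≈G = mk≈₂ λ k w → sym (coeff-≈₂ F≈G k w)

≈₂-trans : ∀ {F G H} → F ≈₂ G → G ≈₂ H → F ≈₂ H
≈₂-trans F≈G G≈H = mk≈₂ λ k w → trans (coeff-≈₂ F≈G k w) (coeff-≈₂ G≈H k w)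

≈₂-setoid : Setoid _ _
≈₂-setoid = record
  { _≈_ = _≈₂_ ; isEquivalence = record { refl = ≈₂-refl ; sym = ≈₂-sym ; trans = ≈₂-trans } }

module ≈₂-Reasoning = SetoidReasoning ≈₂-setoid

one₂ : Series₂
one₂ (+ zero) w = one w
one₂ _        _ = 0ℙ

infixr 5 1+z^_q^_·_ z^_q^_·_ ∏1+z^q^_·_
infixl 6 _[z≔zq⁴]

1+z^_q^_·_ : ℤ → ℤ → Series₂ → Series₂
(1+z^ a q^ b · F) k w = F k w ⊕ F (k -ᶻ a) (w -ᶻ b)

z^_q^_·_ : ℤ → ℤ → Series₂ → Series₂
(z^ a q^ b · F) k w = F (k -ᶻ a) (w -ᶻ b)

_[z≔zq⁴] : Series₂ → Series₂
(F [z≔zq⁴]) k w = F k (w -ᶻ + 4 *ᶻ k)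

1+z^q^-cong : ∀ a b {F G} → F ≈₂ G → 1+z^ a q^ b · F ≈₂ 1+z^ a q^ b · G
1+z^q^-cong a b F≈G = mk≈₂ λ k w → cong₂ _⊕_ (coeff-≈₂ F≈G k w) (coeff-≈₂ F≈G (k -ᶻ a) (w -ᶻ b))

z^q^-cong : ∀ a b {F G} → F ≈₂ G → z^ a q^ b · F ≈₂ z^ a q^ b · G
z^q^-cong a b F≈G = mk≈₂ λ k w → coeff-≈₂ F≈G (k -ᶻ a) (w -ᶻ b)

private
  sub-comm : ∀ x a b → (x -ᶻ a) -ᶻ b ≡ (x -ᶻ b) -ᶻ a
  sub-comm = solve-∀

1+z^q^-comm : ∀ a b c d F → 1+z^ a q^ b · 1+z^ c q^ d · F ≈₂ 1+z^ c q^ d · 1+z^ a q^ b · F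
1+z^q^-comm a b c d F = mk≈₂ λ k w →
  trans (cong (λ (x : Parity) → (F k w ⊕ F (k -ᶻ c) (w -ᶻ d)) ⊕ (F (k -ᶻ a) (w -ᶻ b) ⊕ x))
              (cong₂ F (sub-comm k a c) (sub-comm w b d)))
        (⊕-interchange (F k w) (F (k -ᶻ c) (w -ᶻ d)) (F (k -ᶻ a) (w -ᶻ b)) (F ((k -ᶻ c) -ᶻ a) ((w -ᶻ d) -ᶻ b)))

z^q^-1+z^q^ : ∀ a b c d F → z^ a q^ b · 1+z^ c q^ d · F ≈₂ 1+z^ c q^ d · z^ a q^ b · F
z^q^-1+z^q^ a b c d F = mk≈₂ λ k w →
  cong (F (k -ᶻ a) (w -ᶻ b) ⊕_) (cong₂ F (sub-comm k a c) (sub-comm w b d))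

z^q^-inverse : ∀ a b F → z^ a q^ b · z^ (ℤ.- a) q^ (ℤ.- b) · F ≈₂ F
z^q^-inverse a b F = mk≈₂ λ k w → cong₂ F (cancel k a) (cancel w b)
  where
  cancel : ∀ x y → (x -ᶻ y) -ᶻ ℤ.- y ≡ x
  cancel = solve-∀

-- 1 + z⁻ᵃq⁻ᵇ = z⁻ᵃq⁻ᵇ (1 + zᵃqᵇ): the step that turns the functional equation around.
1+z^q^-invert : ∀ a b F → 1+z^ (ℤ.- a) q^ (ℤ.- b) · F ≈₂ z^ (ℤ.- a) q^ (ℤ.- b) · 1+z^ a q^ b · F
1+z^q^-invert a b F = mk≈₂ λ k w →
  trans (ℙP.+-comm (F k w) (F (k -ᶻ ℤ.- a) (w -ᶻ ℤ.- b)))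
        (cong (F (k -ᶻ ℤ.- a) (w -ᶻ ℤ.- b) ⊕_) (sym (cong₂ F (cancel k a) (cancel w b))))
  where
  cancel : ∀ x y → (x -ᶻ ℤ.- y) -ᶻ y ≡ x
  cancel = solve-∀

1+z^q^-[z≔zq⁴] : ∀ a b F → (1+z^ a q^ b · F) [z≔zq⁴] ≈₂ 1+z^ a q^ (b +ᶻ + 4 *ᶻ a) · F [z≔zq⁴]
1+z^q^-[z≔zq⁴] a b F = mk≈₂ λ k w → cong (λ x → F k (w -ᶻ + 4 *ᶻ k) ⊕ F (k -ᶻ a) x) (regroup w k a b)
  where
  regroup : ∀ w k a b → (w -ᶻ + 4 *ᶻ k) -ᶻ b ≡ (w -ᶻ (b +ᶻ + 4 *ᶻ a)) -ᶻ + 4 *ᶻ (k -ᶻ a)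
  regroup = solve-∀

one₂-[z≔zq⁴] : one₂ [z≔zq⁴] ≈₂ one₂
one₂-[z≔zq⁴] = mk≈₂ coeff
  where
  unchanged : ∀ w → w -ᶻ + 4 *ᶻ + 0 ≡ w
  unchanged = solve-∀
  coeff : ∀ k w → (one₂ [z≔zq⁴]) k w ≡ one₂ k w
  coeff (+ zero)  w = cong one (unchanged w)
  coeff (+ suc _) w = refl
  coeff -[1+ _ ]  w = refl

∏1+z^q^_·_ : List (ℤ × ℤ) → Series₂ → Series₂
∏1+z^q^ []            · F = F
∏1+z^q^ ((a , b) ∷ l) · F = 1+z^ a q^ b · ∏1+z^q^ l · F

∏₂-cong : ∀ l {F G} → F ≈₂ G → ∏1+z^q^ l · F ≈₂ ∏1+z^q^ l · G
∏₂-cong []            F≈G = F≈G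
∏₂-cong ((a , b) ∷ l) F≈G = 1+z^q^-cong a b (∏₂-cong l F≈G)

1+z^q^-∏₂ : ∀ a b l F → 1+z^ a q^ b · ∏1+z^q^ l · F ≈₂ ∏1+z^q^ l · 1+z^ a q^ b · F
1+z^q^-∏₂ a b []            F = ≈₂-refl
1+z^q^-∏₂ a b ((c , d) ∷ l) F =
  ≈₂-trans (1+z^q^-comm a b c d (∏1+z^q^ l · F)) (1+z^q^-cong c d (1+z^q^-∏₂ a b l F))

z^q^-∏₂ : ∀ a b l F → z^ a q^ b · ∏1+z^q^ l · F ≈₂ ∏1+z^q^ l · z^ a q^ b · F
z^q^-∏₂ a b []            F = ≈₂-refl
z^q^-∏₂ a b ((c , d) ∷ l) F =
  ≈₂-trans (z^q^-1+z^q^ a b c d (∏1+z^q^ l · F)) (1+z^q^-cong c d (z^q^-∏₂ a b l F))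

substExp : ℤ × ℤ → ℤ × ℤ
substExp (a , b) = a , b +ᶻ + 4 *ᶻ a

∏₂-[z≔zq⁴] : ∀ l F → (∏1+z^q^ l · F) [z≔zq⁴] ≈₂ ∏1+z^q^ map substExp l · F [z≔zq⁴]
∏₂-[z≔zq⁴] []            F = ≈₂-refl
∏₂-[z≔zq⁴] ((a , b) ∷ l) F =
  ≈₂-trans (1+z^q^-[z≔zq⁴] a b (∏1+z^q^ l · F)) (1+z^q^-cong a (b +ᶻ + 4 *ᶻ a) (∏₂-[z≔zq⁴] l F))

∏₂-∷ʳ : ∀ l a b F → ∏1+z^q^ (l ∷ʳ (a , b)) · F ≡ ∏1+z^q^ l · 1+z^ a q^ b · F
∏₂-∷ʳ []            a b F = refl
∏₂-∷ʳ ((c , d) ∷ l) a b F = cong (1+z^ c q^ d ·_) (∏₂-∷ʳ l a b F)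

posExps : ℕ → ℕ → List (ℤ × ℤ)
posExps s zero    = []
posExps s (suc N) = (1ℤ , + (3 + (s + N) * 4)) ∷ posExps s N

negExps : ℕ → List (ℤ × ℤ)
negExps zero    = []
negExps (suc M) = (-1ℤ , + (1 + M * 4)) ∷ negExps M

jacobi : ℕ → ℕ → Series₂
jacobi N M = ∏1+z^q^ posExps 0 N · ∏1+z^q^ negExps M · one₂

posExps-peel : ∀ s N → posExps s (suc N) ≡ posExps (suc s) N ∷ʳ (1ℤ , + (3 + s * 4))
posExps-peel s zero    = cong (λ x → (1ℤ , + (3 + x * 4)) ∷ []) (ℕP.+-identityʳ s)
posExps-peel s (suc N) =
  cong₂ _∷_ (cong (λ x → 1ℤ , + (3 + x * 4)) (ℕP.+-suc s N)) (posExps-peel s N)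

posExps-subst : ∀ s N → map substExp (posExps s N) ≡ posExps (suc s) N
posExps-subst s zero    = refl
posExps-subst s (suc N) = cong₂ _∷_ (cong (λ x → 1ℤ , + x) (shift (s + N))) (posExps-subst s N)
  where
  shift : ∀ x → (3 + x * 4) + 4 ≡ 3 + suc x * 4
  shift = ℕSolver.solve-∀

negExps-subst : ∀ M → map substExp (negExps (suc M)) ≡ negExps M ∷ʳ (-1ℤ , ℤ.- + 3)
negExps-subst zero    = refl
negExps-subst (suc M) = cong₂ _∷_ (cong (-1ℤ ,_) (ℤP.⊖-≥ (s≤s (s≤s (s≤s (s≤s z≤n)))))) (negExps-subst M)

jacobi-functional : ∀ N M → jacobi (suc N) M ≈₂ z^ 1ℤ q^ + 3 · jacobi N (suc M) [z≔zq⁴]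
jacobi-functional N M = begin
  jacobi (suc N) M
    ≡⟨ cong (λ l → ∏1+z^q^ l · B· one₂) (posExps-peel 0 N) ⟩
  ∏1+z^q^ (posExps 1 N ∷ʳ (1ℤ , + 3)) · B· one₂
    ≡⟨ ∏₂-∷ʳ (posExps 1 N) 1ℤ (+ 3) (B· one₂) ⟩
  A· 1+z^ 1ℤ q^ + 3 · B· one₂
    ≈⟨ ∏₂-cong (posExps 1 N) (1+z^q^-∏₂ 1ℤ (+ 3) (negExps M) one₂) ⟩
  A· B· 1+z^ 1ℤ q^ + 3 · one₂
    ≈⟨ z^q^-inverse 1ℤ (+ 3) (A· B· 1+z^ 1ℤ q^ + 3 · one₂) ⟨
  z^ 1ℤ q^ + 3 · z^ -1ℤ q^ ℤ.- + 3 · A· B· 1+z^ 1ℤ q^ + 3 · one₂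
    ≈⟨ z^q^-cong 1ℤ (+ 3) (≈₂-trans (z^q^-∏₂ -1ℤ (ℤ.- + 3) (posExps 1 N) (B· 1+z^ 1ℤ q^ + 3 · one₂))
         (∏₂-cong (posExps 1 N) (z^q^-∏₂ -1ℤ (ℤ.- + 3) (negExps M) (1+z^ 1ℤ q^ + 3 · one₂)))) ⟩
  z^ 1ℤ q^ + 3 · A· B· z^ -1ℤ q^ ℤ.- + 3 · 1+z^ 1ℤ q^ + 3 · one₂
    ≈⟨ z^q^-cong 1ℤ (+ 3) (∏₂-cong (posExps 1 N) (∏₂-cong (negExps M) (1+z^q^-invert 1ℤ (+ 3) one₂))) ⟨
  z^ 1ℤ q^ + 3 · A· B· 1+z^ -1ℤ q^ ℤ.- + 3 · one₂
    ≡⟨ cong (λ F → z^ 1ℤ q^ + 3 · A· F) (sym (∏₂-∷ʳ (negExps M) -1ℤ (ℤ.- + 3) one₂)) ⟩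
  z^ 1ℤ q^ + 3 · A· ∏1+z^q^ (negExps M ∷ʳ (-1ℤ , ℤ.- + 3)) · one₂
    ≡⟨ cong₂ (λ l l′ → z^ 1ℤ q^ + 3 · ∏1+z^q^ l · ∏1+z^q^ l′ · one₂)
             (sym (posExps-subst 0 N)) (sym (negExps-subst M)) ⟩
  z^ 1ℤ q^ + 3 · A′· B′· one₂
    ≈⟨ z^q^-cong 1ℤ (+ 3) (∏₂-cong (map substExp (posExps 0 N))
                            (∏₂-cong (map substExp (negExps (suc M))) one₂-[z≔zq⁴])) ⟨
  z^ 1ℤ q^ + 3 · A′· B′· one₂ [z≔zq⁴]
    ≈⟨ z^q^-cong 1ℤ (+ 3) (≈₂-trans (∏₂-[z≔zq⁴] (posExps 0 N) (∏1+z^q^ negExps (suc M) · one₂))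
         (∏₂-cong (map substExp (posExps 0 N)) (∏₂-[z≔zq⁴] (negExps (suc M)) one₂))) ⟨
  z^ 1ℤ q^ + 3 · jacobi N (suc M) [z≔zq⁴] ∎
  where
  open ≈₂-Reasoning
  infixr 5 A·_ B·_ A′·_ B′·_
  A·_ B·_ A′·_ B′·_ : Series₂ → Series₂
  A· F  = ∏1+z^q^ posExps 1 N · F
  B· F  = ∏1+z^q^ negExps M · F
  A′· F = ∏1+z^q^ map substExp (posExps 0 N) · F
  B′· F = ∏1+z^q^ map substExp (negExps (suc M)) · F

jacobi-step : ∀ N M k w →
  jacobi (suc N) M k w ≡ jacobi N (suc M) (k -ᶻ 1ℤ) ((w -ᶻ + 3) -ᶻ + 4 *ᶻ (k -ᶻ 1ℤ))
jacobi-step N M = coeff-≈₂ (jacobi-functional N M)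

private
  -m-1≡-[1+m] : ∀ m → ℤ.- + m -ᶻ 1ℤ ≡ -[1+ m ]
  -m-1≡-[1+m] zero    = refl
  -m-1≡-[1+m] (suc m) = trans (-[1+m]-n≡-[1+m+n] m 1) (cong -[1+_] (ℕP.+-comm m 1))

  tri-step⁺ : ∀ n w → ((w -ᶻ + 3) -ᶻ + 4 *ᶻ + n) -ᶻ + tri (+ n) ≡ w -ᶻ + tri (+ suc n)
  tri-step⁺ n w = begin
    ((w -ᶻ + 3) -ᶻ + 4 *ᶻ + n) -ᶻ + tri (+ n)
      ≡⟨ cong (((w -ᶻ + 3) -ᶻ + 4 *ᶻ + n) -ᶻ_) (+tri (+ n)) ⟩
    ((w -ᶻ + 3) -ᶻ + 4 *ᶻ + n) -ᶻ (+ n +ᶻ + 2 *ᶻ (+ n *ᶻ + n))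
      ≡⟨ expand (+ n) w ⟩
    w -ᶻ ((1ℤ +ᶻ + n) +ᶻ + 2 *ᶻ ((1ℤ +ᶻ + n) *ᶻ (1ℤ +ᶻ + n)))
      ≡⟨ cong (λ x → w -ᶻ (x +ᶻ + 2 *ᶻ (x *ᶻ x))) (ℤP.pos-+ 1 n) ⟨
    w -ᶻ (+ suc n +ᶻ + 2 *ᶻ (+ suc n *ᶻ + suc n))
      ≡⟨ cong (w -ᶻ_) (+tri (+ suc n)) ⟨
    w -ᶻ + tri (+ suc n) ∎
    where
    open ≡-Reasoning
    expand : ∀ x w → ((w -ᶻ + 3) -ᶻ + 4 *ᶻ x) -ᶻ (x +ᶻ + 2 *ᶻ (x *ᶻ x))
                   ≡ w -ᶻ ((1ℤ +ᶻ x) +ᶻ + 2 *ᶻ ((1ℤ +ᶻ x) *ᶻ (1ℤ +ᶻ x)))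
    expand = solve-∀

  tri-step⁻ : ∀ m w → ((w +ᶻ + 3) +ᶻ + 4 *ᶻ (ℤ.- + m -ᶻ 1ℤ)) -ᶻ + tri (ℤ.- + m) ≡ w -ᶻ + tri -[1+ m ]
  tri-step⁻ m w = begin
    ((w +ᶻ + 3) +ᶻ + 4 *ᶻ (ℤ.- x -ᶻ 1ℤ)) -ᶻ + tri (ℤ.- x)
      ≡⟨ cong (((w +ᶻ + 3) +ᶻ + 4 *ᶻ (ℤ.- x -ᶻ 1ℤ)) -ᶻ_) (+tri (ℤ.- x)) ⟩
    ((w +ᶻ + 3) +ᶻ + 4 *ᶻ (ℤ.- x -ᶻ 1ℤ)) -ᶻ (ℤ.- x +ᶻ + 2 *ᶻ (ℤ.- x *ᶻ ℤ.- x))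
      ≡⟨ expand x w ⟩
    w -ᶻ ((ℤ.- x -ᶻ 1ℤ) +ᶻ + 2 *ᶻ ((ℤ.- x -ᶻ 1ℤ) *ᶻ (ℤ.- x -ᶻ 1ℤ)))
      ≡⟨ cong (λ y → w -ᶻ (y +ᶻ + 2 *ᶻ (y *ᶻ y))) (-m-1≡-[1+m] m) ⟩
    w -ᶻ (-[1+ m ] +ᶻ + 2 *ᶻ (-[1+ m ] *ᶻ -[1+ m ]))
      ≡⟨ cong (w -ᶻ_) (+tri -[1+ m ]) ⟨
    w -ᶻ + tri -[1+ m ] ∎
    where
    open ≡-Reasoning
    x = + m
    expand : ∀ x w → ((w +ᶻ + 3) +ᶻ + 4 *ᶻ (ℤ.- x -ᶻ 1ℤ)) -ᶻ (ℤ.- x +ᶻ + 2 *ᶻ (ℤ.- x *ᶻ ℤ.- x))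
                   ≡ w -ᶻ ((ℤ.- x -ᶻ 1ℤ) +ᶻ + 2 *ᶻ ((ℤ.- x -ᶻ 1ℤ) *ᶻ (ℤ.- x -ᶻ 1ℤ)))
    expand = solve-∀

-- Iterating the functional equation: the coefficient of zᵏ is q^{tri k} times a constant term.
jacobi-coeff⁺ : ∀ n N M w → jacobi (N + n) M (+ n) w ≡ jacobi N (M + n) 0ℤ (w -ᶻ + tri (+ n))
jacobi-coeff⁺ zero N M w =
  trans (cong₂ (λ N′ M′ → jacobi N′ M′ 0ℤ w) (ℕP.+-identityʳ N) (sym (ℕP.+-identityʳ M)))
        (cong (jacobi N (M + 0) 0ℤ) (sym (ℤP.+-identityʳ w)))
jacobi-coeff⁺ (suc n) N M w = begin
  jacobi (N + suc n) M (+ suc n) w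
    ≡⟨ cong (λ N′ → jacobi N′ M (+ suc n) w) (ℕP.+-suc N n) ⟩
  jacobi (suc (N + n)) M (+ suc n) w
    ≡⟨ jacobi-step (N + n) M (+ suc n) w ⟩
  jacobi (N + n) (suc M) (+ suc n -ᶻ 1ℤ) ((w -ᶻ + 3) -ᶻ + 4 *ᶻ (+ suc n -ᶻ 1ℤ))
    ≡⟨ cong (λ k → jacobi (N + n) (suc M) k ((w -ᶻ + 3) -ᶻ + 4 *ᶻ k)) (m-n≡m∸n (s≤s z≤n)) ⟩
  jacobi (N + n) (suc M) (+ n) ((w -ᶻ + 3) -ᶻ + 4 *ᶻ + n)
    ≡⟨ jacobi-coeff⁺ n N (suc M) ((w -ᶻ + 3) -ᶻ + 4 *ᶻ + n) ⟩
  jacobi N (suc M + n) 0ℤ (((w -ᶻ + 3) -ᶻ + 4 *ᶻ + n) -ᶻ + tri (+ n))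
    ≡⟨ cong₂ (λ M′ x → jacobi N M′ 0ℤ x) (sym (ℕP.+-suc M n)) (tri-step⁺ n w) ⟩
  jacobi N (M + suc n) 0ℤ (w -ᶻ + tri (+ suc n)) ∎
  where open ≡-Reasoning

jacobi-coeff⁻ : ∀ m N M w → jacobi N (M + m) (ℤ.- + m) w ≡ jacobi (N + m) M 0ℤ (w -ᶻ + tri (ℤ.- + m))
jacobi-coeff⁻ zero N M w =
  trans (cong₂ (λ N′ M′ → jacobi N′ M′ 0ℤ w) (sym (ℕP.+-identityʳ N)) (ℕP.+-identityʳ M))
        (cong (jacobi (N + 0) M 0ℤ) (sym (ℤP.+-identityʳ w)))
jacobi-coeff⁻ (suc m) N M w = begin
  jacobi N (M + suc m) -[1+ m ] w
    ≡⟨ cong (λ M′ → jacobi N M′ -[1+ m ] w) (ℕP.+-suc M m) ⟩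
  jacobi N (suc (M + m)) -[1+ m ] w
    ≡⟨ cong₂ (jacobi N (suc (M + m))) (-m-1≡-[1+m] m) (undo w (ℤ.- + m)) ⟨
  jacobi N (suc (M + m)) (ℤ.- + m -ᶻ 1ℤ) ((w′ -ᶻ + 3) -ᶻ + 4 *ᶻ (ℤ.- + m -ᶻ 1ℤ))
    ≡⟨ jacobi-step N (M + m) (ℤ.- + m) w′ ⟨
  jacobi (suc N) (M + m) (ℤ.- + m) w′
    ≡⟨ jacobi-coeff⁻ m (suc N) M w′ ⟩
  jacobi (suc N + m) M 0ℤ (w′ -ᶻ + tri (ℤ.- + m))
    ≡⟨ cong₂ (λ N′ x → jacobi N′ M 0ℤ x) (sym (ℕP.+-suc N m)) (tri-step⁻ m w) ⟩
  jacobi (N + suc m) M 0ℤ (w -ᶻ + tri -[1+ m ]) ∎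
  where
  open ≡-Reasoning
  w′ = (w +ᶻ + 3) +ᶻ + 4 *ᶻ (ℤ.- + m -ᶻ 1ℤ)
  undo : ∀ w k → (((w +ᶻ + 3) +ᶻ + 4 *ᶻ (k -ᶻ 1ℤ)) -ᶻ + 3) -ᶻ + 4 *ᶻ (k -ᶻ 1ℤ) ≡ w
  undo = solve-∀

-- Each factor 1 + z q^b (b ≥ 2) or 1 + z⁻¹ q^b (b ≥ 1) preserves this cone; it keeps every sum over k finite.
record InCone (F : Series₂) : Set where
  constructor mkInCone
  field cone : ∀ k w → F k w ≡ 1ℙ → 0ℤ ℤ.≤ w × 0ℤ ℤ.≤ w -ᶻ (k +ᶻ k) × 0ℤ ℤ.≤ w +ᶻ k
open InCone public

inCone-neg : ∀ {F} → InCone F → ∀ k m → F k -[1+ m ] ≡ 0ℙ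
inCone-neg {F} inF k m with F k -[1+ m ] in eq
... | 0ℙ = refl
... | 1ℙ with cone inF k -[1+ m ] eq
...   | () , _

private
  nonneg-sum : ∀ {x y z} → 0ℤ ℤ.≤ x → 0ℤ ℤ.≤ y → ∀ n → x +ᶻ y +ᶻ + n ≡ z → 0ℤ ℤ.≤ z
  nonneg-sum 0≤x 0≤y n refl = ℤP.+-mono-≤ (ℤP.+-mono-≤ 0≤x 0≤y) (ℤ.+≤+ z≤n)

1+zq^-inCone : ∀ {b F} → 0ℤ ℤ.≤ b -ᶻ + 2 → InCone F → InCone (1+z^ 1ℤ q^ b · F)
1+zq^-inCone {b} {F} 0≤b-2 inF = mkInCone λ k w eq → case (⊕≡1ℙ⇒⊎ _ _ eq)
  where
  case : ∀ {k w} → F k w ≡ 1ℙ ⊎ F (k -ᶻ 1ℤ) (w -ᶻ b) ≡ 1ℙ →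
         0ℤ ℤ.≤ w × 0ℤ ℤ.≤ w -ᶻ (k +ᶻ k) × 0ℤ ℤ.≤ w +ᶻ k
  case {k} {w} (inj₁ eq) = cone inF k w eq
  case {k} {w} (inj₂ eq) with cone inF (k -ᶻ 1ℤ) (w -ᶻ b) eq
  ... | 0≤w′ , 0≤w′-2k′ , 0≤w′+k′ =
    nonneg-sum 0≤w′ 0≤b-2 2 (e₁ w b) , nonneg-sum 0≤w′-2k′ 0≤b-2 0 (e₂ w k b) ,
    nonneg-sum 0≤w′+k′ 0≤b-2 3 (e₃ w k b)
    where
    e₁ : ∀ w b → (w -ᶻ b) +ᶻ (b -ᶻ + 2) +ᶻ + 2 ≡ w
    e₁ = solve-∀
    e₂ : ∀ w k b → ((w -ᶻ b) -ᶻ ((k -ᶻ 1ℤ) +ᶻ (k -ᶻ 1ℤ))) +ᶻ (b -ᶻ + 2) +ᶻ + 0 ≡ w -ᶻ (k +ᶻ k)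
    e₂ = solve-∀
    e₃ : ∀ w k b → ((w -ᶻ b) +ᶻ (k -ᶻ 1ℤ)) +ᶻ (b -ᶻ + 2) +ᶻ + 3 ≡ w +ᶻ k
    e₃ = solve-∀

1+z⁻¹q^-inCone : ∀ {b F} → 0ℤ ℤ.≤ b -ᶻ 1ℤ → InCone F → InCone (1+z^ -1ℤ q^ b · F)
1+z⁻¹q^-inCone {b} {F} 0≤b-1 inF = mkInCone λ k w eq → case (⊕≡1ℙ⇒⊎ _ _ eq)
  where
  case : ∀ {k w} → F k w ≡ 1ℙ ⊎ F (k -ᶻ -1ℤ) (w -ᶻ b) ≡ 1ℙ →
         0ℤ ℤ.≤ w × 0ℤ ℤ.≤ w -ᶻ (k +ᶻ k) × 0ℤ ℤ.≤ w +ᶻ k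
  case {k} {w} (inj₁ eq) = cone inF k w eq
  case {k} {w} (inj₂ eq) with cone inF (k -ᶻ -1ℤ) (w -ᶻ b) eq
  ... | 0≤w′ , 0≤w′-2k′ , 0≤w′+k′ =
    nonneg-sum 0≤w′ 0≤b-1 1 (e₁ w b) , nonneg-sum 0≤w′-2k′ 0≤b-1 3 (e₂ w k b) ,
    nonneg-sum 0≤w′+k′ 0≤b-1 0 (e₃ w k b)
    where
    e₁ : ∀ w b → (w -ᶻ b) +ᶻ (b -ᶻ 1ℤ) +ᶻ 1ℤ ≡ w
    e₁ = solve-∀
    e₂ : ∀ w k b → ((w -ᶻ b) -ᶻ ((k -ᶻ -1ℤ) +ᶻ (k -ᶻ -1ℤ))) +ᶻ (b -ᶻ 1ℤ) +ᶻ + 3 ≡ w -ᶻ (k +ᶻ k)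
    e₂ = solve-∀
    e₃ : ∀ w k b → ((w -ᶻ b) +ᶻ (k -ᶻ -1ℤ)) +ᶻ (b -ᶻ 1ℤ) +ᶻ + 0 ≡ w +ᶻ k
    e₃ = solve-∀

one₂-inCone : InCone one₂
one₂-inCone = mkInCone cone-one₂
  where
  cone-one₂ : ∀ k w → one₂ k w ≡ 1ℙ → 0ℤ ℤ.≤ w × 0ℤ ℤ.≤ w -ᶻ (k +ᶻ k) × 0ℤ ℤ.≤ w +ᶻ k
  cone-one₂ (+ zero) (+ zero) _ = ℤ.+≤+ z≤n , ℤ.+≤+ z≤n , ℤ.+≤+ z≤n

posExps-inCone : ∀ s N {F} → InCone F → InCone (∏1+z^q^ posExps s N · F)
posExps-inCone s zero    inF = inF
posExps-inCone s (suc N) inF =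
  1+zq^-inCone (subst (0ℤ ℤ.≤_) (sym (m-n≡m∸n (s≤s (s≤s z≤n)))) (ℤ.+≤+ z≤n)) (posExps-inCone s N inF)

negExps-inCone : ∀ M {F} → InCone F → InCone (∏1+z^q^ negExps M · F)
negExps-inCone zero    inF = inF
negExps-inCone (suc M) inF =
  1+z⁻¹q^-inCone (subst (0ℤ ℤ.≤_) (sym (m-n≡m∸n (s≤s z≤n))) (ℤ.+≤+ z≤n)) (negExps-inCone M inF)

jacobi-inCone : ∀ N M → InCone (jacobi N M)
jacobi-inCone N M = posExps-inCone 0 N (negExps-inCone M one₂-inCone)

infix 4 _≈₂[_]_

record _≈₂[_]_ (F : Series₂) (L : ℕ) (G : Series₂) : Set where
  constructor mk≈₂[]
  field coeff-≈₂[] : ∀ k n → n ≤ L → F k (+ n) ≡ G k (+ n)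
open _≈₂[_]_ public

≈₂[]-trans : ∀ {F G H L} → F ≈₂[ L ] G → G ≈₂[ L ] H → F ≈₂[ L ] H
≈₂[]-trans F≈G G≈H = mk≈₂[] λ k n n≤L → trans (coeff-≈₂[] F≈G k n n≤L) (coeff-≈₂[] G≈H k n n≤L)

≈₂⇒≈₂[] : ∀ {F G L} → F ≈₂ G → F ≈₂[ L ] G
≈₂⇒≈₂[] F≈G = mk≈₂[] λ k n _ → coeff-≈₂ F≈G k (+ n)

1+z^q^-high : ∀ a {b F L} → InCone F → L < b → 1+z^ a q^ + b · F ≈₂[ L ] F
1+z^q^-high a {b} {F} inF L<b = mk≈₂[] λ k n n≤L →
  trans (cong (F k (+ n) ⊕_) (trans (cong (F (k -ᶻ a)) (m-n≡-[1+n∸1+m] (ℕP.≤-<-trans n≤L L<b)))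
                                    (inCone-neg inF (k -ᶻ a) _)))
        (ℙP.+-identityʳ _)

module _ {L : ℕ} where

  private
    L<r+[d+N]*4 : ∀ {N} r → L < N → ∀ d → L < r + (d + N) * 4
    L<r+[d+N]*4 {N} r L<N d = ℕP.<-≤-trans L<N
      (ℕP.≤-trans (ℕP.m≤n+m N d) (ℕP.≤-trans (ℕP.m≤m*n (d + N) 4) (ℕP.m≤n+m _ r)))

  jacobi-stableᴺ : ∀ d {N M} → L < N → jacobi (d + N) M ≈₂[ L ] jacobi N M
  jacobi-stableᴺ zero    L<N = mk≈₂[] λ _ _ _ → refl
  jacobi-stableᴺ (suc d) {N} {M} L<N =
    ≈₂[]-trans (1+z^q^-high 1ℤ (jacobi-inCone (d + N) M) (L<r+[d+N]*4 3 L<N d)) (jacobi-stableᴺ d {N} {M} L<N)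

  jacobi-stableᴹ : ∀ d {N M} → L < M → jacobi N (d + M) ≈₂[ L ] jacobi N M
  jacobi-stableᴹ zero    L<M = mk≈₂[] λ _ _ _ → refl
  jacobi-stableᴹ (suc d) {N} {M} L<M =
    ≈₂[]-trans (≈₂⇒≈₂[] (≈₂-sym (1+z^q^-∏₂ -1ℤ (+ (1 + (d + M) * 4)) (posExps 0 N) (∏1+z^q^ negExps (d + M) · one₂))))
    (≈₂[]-trans (1+z^q^-high -1ℤ (jacobi-inCone N (d + M)) (L<r+[d+N]*4 1 L<M d)) (jacobi-stableᴹ d {N} {M} L<M))

  jacobi-stable : ∀ {N M} → L < N → L < M → jacobi N M ≈₂[ L ] jacobi (suc L) (suc L)
  jacobi-stable {N} {M} L<N L<M =
    subst (λ N′ → jacobi N′ M ≈₂[ L ] jacobi (suc L) (suc L)) (ℕP.m∸n+n≡m L<N)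
      (≈₂[]-trans (jacobi-stableᴺ (N ∸ suc L) {suc L} {M} ℕP.≤-refl)
        (subst (λ M′ → jacobi (suc L) M′ ≈₂[ L ] jacobi (suc L) (suc L)) (ℕP.m∸n+n≡m L<M)
          (jacobi-stableᴹ (M ∸ suc L) {suc L} {suc L} ℕP.≤-refl)))

-- eval c F is F(q⁻ᶜ, q): the coefficient of q^x collects the terms zᵏ q^{x + c k}.
eval : ℕ → Series₂ → Series
eval c F x = Σ[∣ k ∣≤ ∣ x ∣ ] F k (x +ᶻ + c *ᶻ k)

private
  0≤m-n⇒n≤m : ∀ {m n} → 0ℤ ℤ.≤ + m -ᶻ + n → n ≤ m
  0≤m-n⇒n≤m {m} {n} 0≤m-n = ℤP.drop‿+≤+ (ℤP.0≤i-j⇒j≤i 0≤m-n)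

inCone-eval-neg : ∀ {F c} → InCone F → c ≤ 1 → ∀ m k → F k (-[1+ m ] +ᶻ + c *ᶻ k) ≡ 0ℙ
inCone-eval-neg {F} inF z≤n m k =
  trans (cong (F k) (ℤP.+-identityʳ -[1+ m ])) (inCone-neg inF k m)
inCone-eval-neg {F} inF (s≤s z≤n) m k with F k (-[1+ m ] +ᶻ + 1 *ᶻ k) in eq
... | 0ℙ = refl
... | 1ℙ with cone inF k _ eq
...   | 0≤w , 0≤w-2k , _ = ⊥-elim (negative (nonneg-sum 0≤w-2k 0≤w 0 (twice -[1+ m ] k)))
  where
  twice : ∀ u k → ((u +ᶻ 1ℤ *ᶻ k) -ᶻ (k +ᶻ k)) +ᶻ (u +ᶻ 1ℤ *ᶻ k) +ᶻ + 0 ≡ u +ᶻ u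
  twice = solve-∀
  negative : ¬ (0ℤ ℤ.≤ -[1+ m ] +ᶻ -[1+ m ])
  negative ()

inCone-eval-bound : ∀ {F c} → InCone F → c ≤ 1 → ∀ r k → F k (+ r +ᶻ + c *ᶻ k) ≡ 1ℙ → ∣ k ∣ ≤ r
inCone-eval-bound {F} inF z≤n r k eq with cone inF k (+ r) (trans (cong (F k) (sym (ℤP.+-identityʳ (+ r)))) eq)
inCone-eval-bound inF z≤n r (+ j)    eq | _ , 0≤r-2j , _ = ℕP.≤-trans (ℕP.m≤m+n j j) (0≤m-n⇒n≤m 0≤r-2j)
inCone-eval-bound inF z≤n r -[1+ j ] eq | _ , _ , 0≤r+k = 0≤m-n⇒n≤m 0≤r+k
inCone-eval-bound {F} inF (s≤s z≤n) r k eq with cone inF k _ eq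
inCone-eval-bound inF (s≤s z≤n) r (+ j)    eq | _ , 0≤w-2j , _ =
  0≤m-n⇒n≤m (subst (0ℤ ℤ.≤_) (simplify (+ r) (+ j)) 0≤w-2j)
  where
  simplify : ∀ r j → (r +ᶻ 1ℤ *ᶻ j) -ᶻ (j +ᶻ j) ≡ r -ᶻ j
  simplify = solve-∀
inCone-eval-bound inF (s≤s z≤n) r -[1+ j ] eq | 0≤w , _ , _ =
  0≤m-n⇒n≤m (subst (0ℤ ℤ.≤_) (cong (+ r +ᶻ_) (ℤP.*-identityˡ -[1+ j ])) 0≤w)

eval-isPowerSeries : ∀ {c F} → c ≤ 1 → InCone F → IsPowerSeries (eval c F)
eval-isPowerSeries c≤1 inF = mkPowerSeries λ m → symSum-zero (suc m) (inCone-eval-neg inF c≤1 m)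

private
  eval-vanishes : ∀ {c F} → InCone F → c ≤ 1 → ∀ r → VanishesBeyond r (λ k → F k (+ r +ᶻ + c *ᶻ k))
  eval-vanishes {c} {F} inF c≤1 r k r<∣k∣ with F k (+ r +ᶻ + c *ᶻ k) in eq
  ... | 0ℙ = refl
  ... | 1ℙ = ⊥-elim (ℕP.<⇒≱ r<∣k∣ (inCone-eval-bound inF c≤1 r k eq))

eval-1+z^q^ : ∀ {c a b e F} → c ≤ 1 → InCone F → a ≡ 1ℤ ⊎ a ≡ -1ℤ → b -ᶻ + c *ᶻ a ≡ + e → 0 < e →
              eval c (1+z^ a q^ b · F) ≈ 1+q^ e · eval c F
eval-1+z^q^ {c} {a} {b} {e} {F} c≤1 inF ±1 b-ca≡e 0<e = mk≈ λ x → begin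
  Σ[∣ k ∣≤ ∣ x ∣ ] (F k (x +ᶻ + c *ᶻ k) ⊕ F (k -ᶻ a) ((x +ᶻ + c *ᶻ k) -ᶻ b))
    ≡⟨ symSum-⊕ ∣ x ∣ (λ k → F k (x +ᶻ + c *ᶻ k)) (λ k → F (k -ᶻ a) ((x +ᶻ + c *ᶻ k) -ᶻ b)) ⟩
  eval c F x ⊕ (Σ[∣ k ∣≤ ∣ x ∣ ] F (k -ᶻ a) ((x +ᶻ + c *ᶻ k) -ᶻ b))
    ≡⟨ cong (eval c F x ⊕_) (symSum-cong ∣ x ∣ λ k → cong (F (k -ᶻ a)) (regroup x k)) ⟩
  eval c F x ⊕ (Σ[∣ k ∣≤ ∣ x ∣ ] F (k -ᶻ a) ((x -ᶻ + e) +ᶻ + c *ᶻ (k -ᶻ a)))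
    ≡⟨ cong (eval c F x ⊕_) (shifted (x -ᶻ + e) ∣ x ∣ (bound x)) ⟩
  eval c F x ⊕ eval c F (x -ᶻ + e) ∎
  where
  open ≡-Reasoning
  regroup : ∀ x k → (x +ᶻ + c *ᶻ k) -ᶻ b ≡ (x -ᶻ + e) +ᶻ + c *ᶻ (k -ᶻ a)
  regroup x k = trans (expand x k (+ c) a b) (cong (λ y → (x -ᶻ y) +ᶻ + c *ᶻ (k -ᶻ a)) b-ca≡e)
    where
    expand : ∀ x k c a b → (x +ᶻ c *ᶻ k) -ᶻ b ≡ (x -ᶻ (b -ᶻ c *ᶻ a)) +ᶻ c *ᶻ (k -ᶻ a)
    expand = solve-∀
  bound : ∀ x r → x -ᶻ + e ≡ + r → r < ∣ x ∣
  bound (+ n)    r eq = sub-≡+⇒< {n} {e} 0<e eq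
  bound -[1+ m ] r eq with trans (sym (-[1+m]-n≡-[1+m+n] m e)) eq
  ... | ()
  shifted : ∀ y R → (∀ r → y ≡ + r → r < R) →
            Σ[∣ k ∣≤ R ] F (k -ᶻ a) (y +ᶻ + c *ᶻ (k -ᶻ a)) ≡ eval c F y
  shifted (+ r)    R r<R = symSum-shift ±1 (eval-vanishes inF c≤1 r) (r<R r refl)
  shifted -[1+ m ] R _   =
    trans (symSum-zero R λ k → inCone-eval-neg inF c≤1 m (k -ᶻ a))
          (sym (symSum-zero (suc m) (inCone-eval-neg inF c≤1 m)))

eval-one₂ : ∀ c → eval c one₂ ≈ one
eval-one₂ c = mk≈ λ x → trans (symSum-vanishing {R = ∣ x ∣} (beyond0 {x}) z≤n) (cong one (drop x (+ c)))
  where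
  beyond0 : ∀ {x} → VanishesBeyond 0 (λ k → one₂ k (x +ᶻ + c *ᶻ k))
  beyond0 (+ suc _) _ = refl
  beyond0 -[1+ _ ]  _ = refl
  drop : ∀ x y → x +ᶻ y *ᶻ 0ℤ ≡ x
  drop = solve-∀

eval-posExps : ∀ {c F} → c ≤ 1 → InCone F → ∀ N →
               eval c (∏1+z^q^ posExps 0 N · F) ≈ ∏1+q^ progression (3 ∸ c) N · eval c F
eval-posExps c≤1 inF zero    = ≈-refl
eval-posExps {c} {F} c≤1 inF (suc N) =
  ≈-trans (eval-1+z^q^ c≤1 (posExps-inCone 0 N inF) (inj₁ refl) (exponent c≤1) (positive c≤1))
          (1+q^-cong _ (eval-posExps c≤1 inF N))
  where
  exponent : ∀ {c} → c ≤ 1 → + (3 + N * 4) -ᶻ + c *ᶻ 1ℤ ≡ + ((3 ∸ c) + N * 4)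
  exponent z≤n       = ℤP.+-identityʳ _
  exponent (s≤s z≤n) = m-n≡m∸n (s≤s z≤n)
  positive : ∀ {c} → c ≤ 1 → 0 < (3 ∸ c) + N * 4
  positive z≤n       = s≤s z≤n
  positive (s≤s z≤n) = s≤s z≤n

eval-negExps : ∀ {c F} → c ≤ 1 → InCone F → ∀ M →
               eval c (∏1+z^q^ negExps M · F) ≈ ∏1+q^ progression (1 + c) M · eval c F
eval-negExps c≤1 inF zero    = ≈-refl
eval-negExps {c} {F} c≤1 inF (suc M) =
  ≈-trans (eval-1+z^q^ c≤1 (negExps-inCone M inF) (inj₂ refl) (exponent c≤1) (s≤s z≤n))
          (1+q^-cong _ (eval-negExps c≤1 inF M))
  where
  exponent : ∀ {c} → c ≤ 1 → + (1 + M * 4) -ᶻ + c *ᶻ -1ℤ ≡ + ((1 + c) + M * 4)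
  exponent z≤n       = ℤP.+-identityʳ _
  exponent (s≤s z≤n) = cong +_ (ℕP.+-comm (1 + M * 4) 1)

eval-jacobi : ∀ {c} → c ≤ 1 → ∀ N M →
              eval c (jacobi N M) ≈ ∏1+q^ progression (3 ∸ c) N · ∏1+q^ progression (1 + c) M · one
eval-jacobi {c} c≤1 N M =
  ≈-trans (eval-posExps c≤1 (negExps-inCone M one₂-inCone) N)
    (∏-cong (progression _ N) (≈-trans (eval-negExps c≤1 one₂-inCone M) (∏-cong (progression _ M) (eval-one₂ c))))

-- By jacobi-stable, in degrees ≤ L this is the z⁰-coefficient of jacobi N M for all N, M > L.
constTerm : ℕ → Series
constTerm L = jacobi (suc L) (suc L) 0ℤ

constTerm-isPowerSeries : ∀ L → IsPowerSeries (constTerm L)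
constTerm-isPowerSeries L = mkPowerSeries (inCone-neg (jacobi-inCone (suc L) (suc L)) 0ℤ)

module _ (L : ℕ) where

  private
    N = suc (L + L)

    L<N∸j : ∀ {j} → j ≤ L → L < N ∸ j
    L<N∸j {j} j≤L = ℕP.m+n≤o⇒m≤o∸n (suc L) (s≤s (ℕP.+-monoʳ-≤ L j≤L))

    L<N+j : ∀ j → L < N + j
    L<N+j j = s≤s (ℕP.≤-trans (ℕP.m≤m+n L L) (ℕP.m≤m+n (L + L) j))

    j≤N : ∀ {j} → j ≤ L → j ≤ N
    j≤N j≤L = ℕP.≤-trans j≤L (ℕP.≤-trans (ℕP.m≤m+n L L) (ℕP.n≤1+n _))

    stable-at : ∀ {N′ M′} → L < N′ → L < M′ → ∀ x → (∀ n → x ≡ + n → n ≤ L) →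
                jacobi N′ M′ 0ℤ x ≡ constTerm L x
    stable-at L<N′ L<M′ (+ n)    bound = coeff-≈₂[] (jacobi-stable L<N′ L<M′) 0ℤ n (bound n refl)
    stable-at {N′} {M′} _ _ -[1+ m ] _ =
      trans (inCone-neg (jacobi-inCone N′ M′) 0ℤ m) (sym (inCone-neg (jacobi-inCone (suc L) (suc L)) 0ℤ m))

  jacobi-coeff : ∀ k w → ∣ k ∣ ≤ L → (∀ n → w -ᶻ + tri k ≡ + n → n ≤ L) →
                 jacobi N N k w ≡ constTerm L (w -ᶻ + tri k)
  jacobi-coeff (+ j) w j≤L bound = begin
    jacobi N N (+ j) w                       ≡⟨ cong (λ N′ → jacobi N′ N (+ j) w) (ℕP.m∸n+n≡m (j≤N j≤L)) ⟨
    jacobi (N ∸ j + j) N (+ j) w             ≡⟨ jacobi-coeff⁺ j (N ∸ j) N w ⟩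
    jacobi (N ∸ j) (N + j) 0ℤ (w -ᶻ + tri (+ j)) ≡⟨ stable-at (L<N∸j j≤L) (L<N+j j) _ bound ⟩
    constTerm L (w -ᶻ + tri (+ j))           ∎
    where open ≡-Reasoning
  jacobi-coeff -[1+ i ] w i<L bound = begin
    jacobi N N -[1+ i ] w                    ≡⟨ cong (λ M′ → jacobi N M′ -[1+ i ] w) (ℕP.m∸n+n≡m (j≤N i<L)) ⟨
    jacobi N (N ∸ suc i + suc i) -[1+ i ] w  ≡⟨ jacobi-coeff⁻ (suc i) N (N ∸ suc i) w ⟩
    jacobi (N + suc i) (N ∸ suc i) 0ℤ (w -ᶻ + tri -[1+ i ])
      ≡⟨ stable-at (L<N+j (suc i)) (L<N∸j i<L) _ bound ⟩
    constTerm L (w -ᶻ + tri -[1+ i ])        ∎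
    where open ≡-Reasoning

  eval-jacobi-coeff : ∀ {c} → c ≤ 1 → ∀ n → n ≤ L →
    eval c (jacobi N N) (+ n) ≡ Σ[∣ k ∣≤ n ] constTerm L ((+ n +ᶻ + c *ᶻ k) -ᶻ + tri k)
  eval-jacobi-coeff {c} c≤1 n n≤L = symSum-congᴿ n λ k ∣k∣≤n →
    jacobi-coeff k (+ n +ᶻ + c *ᶻ k) (ℕP.≤-trans ∣k∣≤n n≤L)
      λ n′ eq → ℕP.≤-trans (ℤP.drop‿+≤+ (subst (ℤ._≤ + n) eq (degree-drops c≤1 k))) n≤L
    where
    k≤tri : ∀ {c} → c ≤ 1 → ∀ k → + c *ᶻ k ℤ.≤ + tri k
    k≤tri z≤n       k         = ℤ.+≤+ z≤n
    k≤tri (s≤s z≤n) (+ j)     = subst (ℤ._≤ + tri (+ j)) (sym (ℤP.*-identityˡ (+ j))) (ℤ.+≤+ (∣k∣≤tri (+ j)))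
    k≤tri (s≤s z≤n) -[1+ j ]  = subst (ℤ._≤ + tri -[1+ j ]) (sym (ℤP.*-identityˡ -[1+ j ])) ℤ.-≤+
    degree-drops : ∀ {c} → c ≤ 1 → ∀ k → (+ n +ᶻ + c *ᶻ k) -ᶻ + tri k ℤ.≤ + n
    degree-drops {c} c≤1 k = subst₂ ℤ._≤_ (regroup (+ n) (+ c *ᶻ k) (+ tri k)) (ℤP.+-identityʳ (+ n))
      (ℤP.+-monoʳ-≤ (+ n) (ℤP.i≤j⇒i-j≤0 (k≤tri c≤1 k)))
      where
      regroup : ∀ n x t → n +ᶻ (x -ᶻ t) ≡ (n +ᶻ x) -ᶻ t
      regroup = solve-∀

  eval₀-jacobi : eval 0 (jacobi N N) ≈[ L ] θ· constTerm L
  eval₀-jacobi = mk≈[] λ n n≤L → trans (eval-jacobi-coeff z≤n n n≤L)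
    (symSum-cong n λ k → cong (λ x → constTerm L (x -ᶻ + tri k)) (ℤP.+-identityʳ (+ n)))

  -- Since tri k − k = 2k² = tri (−k) + k, the terms for k and −k coincide and cancel.
  eval₁-jacobi : eval 1 (jacobi N N) ≈[ L ] constTerm L
  eval₁-jacobi = mk≈[] λ n n≤L → begin
    eval 1 (jacobi N N) (+ n)                                    ≡⟨ eval-jacobi-coeff (s≤s z≤n) n n≤L ⟩
    Σ[∣ k ∣≤ n ] constTerm L ((+ n +ᶻ 1ℤ *ᶻ k) -ᶻ + tri k)       ≡⟨ symSum-even n _ (even n) ⟩
    constTerm L ((+ n +ᶻ 1ℤ *ᶻ 0ℤ) -ᶻ + 0)                       ≡⟨ cong (constTerm L) (drop (+ n)) ⟩
    constTerm L (+ n)                                            ∎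
    where
    open ≡-Reasoning
    drop : ∀ x → (x +ᶻ 1ℤ *ᶻ 0ℤ) -ᶻ 0ℤ ≡ x
    drop = solve-∀
    even : ∀ n j → constTerm L ((+ n +ᶻ 1ℤ *ᶻ + suc j) -ᶻ + tri (+ suc j))
                 ≡ constTerm L ((+ n +ᶻ 1ℤ *ᶻ -[1+ j ]) -ᶻ + tri -[1+ j ])
    even n j = cong (constTerm L) (begin
      (+ n +ᶻ 1ℤ *ᶻ k) -ᶻ + tri k
        ≡⟨ cong ((+ n +ᶻ 1ℤ *ᶻ k) -ᶻ_) (+tri k) ⟩
      (+ n +ᶻ 1ℤ *ᶻ k) -ᶻ (k +ᶻ + 2 *ᶻ (k *ᶻ k))
        ≡⟨ symmetric (+ n) k ⟩
      (+ n +ᶻ 1ℤ *ᶻ ℤ.- k) -ᶻ (ℤ.- k +ᶻ + 2 *ᶻ (ℤ.- k *ᶻ ℤ.- k))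
        ≡⟨ cong ((+ n +ᶻ 1ℤ *ᶻ ℤ.- k) -ᶻ_) (+tri (ℤ.- k)) ⟨
      (+ n +ᶻ 1ℤ *ᶻ ℤ.- k) -ᶻ + tri (ℤ.- k) ∎)
      where
      k = + suc j
      symmetric : ∀ n k → (n +ᶻ 1ℤ *ᶻ k) -ᶻ (k +ᶻ + 2 *ᶻ (k *ᶻ k))
                        ≡ (n +ᶻ 1ℤ *ᶻ ℤ.- k) -ᶻ (ℤ.- k +ᶻ + 2 *ᶻ (ℤ.- k *ᶻ ℤ.- k))
      symmetric = solve-∀

  odd-product≈θ·twice-even-product :
    ∏1+q^ progression 3 N · ∏1+q^ progression 1 N · one
      ≈[ L ] θ· ∏1+q^ progression 2 N · ∏1+q^ progression 2 N · one
  odd-product≈θ·twice-even-product = begin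
    ∏1+q^ progression 3 N · ∏1+q^ progression 1 N · one       ≈⟨ ≈⇒≈[] (eval-jacobi z≤n N N) ⟨
    eval 0 (jacobi N N)                                       ≈⟨ eval₀-jacobi ⟩
    θ· constTerm L
      ≈⟨ θ-cong-≈[] (constTerm-isPowerSeries L) (eval-isPowerSeries (s≤s z≤n) (jacobi-inCone N N)) (≈[]-sym eval₁-jacobi) ⟩
    θ· eval 1 (jacobi N N)                                    ≈⟨ ≈⇒≈[] (θ-cong (eval-jacobi (s≤s z≤n) N N)) ⟩
    θ· ∏1+q^ progression 2 N · ∏1+q^ progression 2 N · one    ∎
    where open ≈[]-Reasoning L

sumMultiples-fuel : ∀ a b d r f → r ≤ a → r ≤ b → sumMultiples a (suc d) r f ≡ sumMultiples b (suc d) r f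
sumMultiples-fuel zero    zero    d r       f _ _ = refl
sumMultiples-fuel zero    (suc b) d zero    f _ _ with suc d ≤? zero
... | no _ = refl
sumMultiples-fuel (suc a) zero    d zero    f _ _ with suc d ≤? zero
... | no _ = refl
sumMultiples-fuel (suc a) (suc b) d r       f r≤1+a r≤1+b with suc d ≤? r
... | yes _ = cong (λ y → f r + y) (sumMultiples-fuel a b d (r ∸ suc d) f (shrink r≤1+a) (shrink r≤1+b))
  where
  shrink : ∀ {a} → r ≤ suc a → r ∸ suc d ≤ a
  shrink r≤1+a = ℕP.≤-trans (ℕP.∸-monoʳ-≤ r (s≤s z≤n)) (ℕP.∸-monoˡ-≤ 1 r≤1+a)
... | no  _ = refl

sumMultiples-step : ∀ fuel d r f → suc d ≤ r →
                    sumMultiples (suc fuel) (suc d) r f ≡ f r + sumMultiples fuel (suc d) (r ∸ suc d) f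
sumMultiples-step fuel d r f d<r with suc d ≤? r
... | yes _   = refl
... | no  d≮r = ⊥-elim (d≮r d<r)

sumMultiples-small : ∀ fuel d r f → r < suc d → sumMultiples fuel (suc d) r f ≡ f r
sumMultiples-small zero       d r f _   = refl
sumMultiples-small (suc fuel) d r f r≤d with suc d ≤? r
... | yes d<r = ⊥-elim (ℕP.<⇒≱ r≤d d<r)
... | no  _   = refl

pk-∣4 : ∀ k n → 4 ∣ suc k → pk (suc k) n ≡ pk k n
pk-∣4 k n 4∣1+k with 4 ∣? suc k
... | yes _   = refl
... | no 4∤1+k = ⊥-elim (4∤1+k 4∣1+k)

pk-small : ∀ k n → n < suc k → pk (suc k) n ≡ pk k n
pk-small k n n≤k with 4 ∣? suc k
... | yes _ = refl
... | no  _ = sumMultiples-small n k n (pk k) n≤k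

pk-step : ∀ k n → ¬ 4 ∣ suc k → suc k ≤ n → pk (suc k) n ≡ pk k n + pk (suc k) (n ∸ suc k)
pk-step k (suc n) 4∤1+k (s≤s k≤n) with 4 ∣? suc k
... | yes 4∣1+k = ⊥-elim (4∤1+k 4∣1+k)
... | no  _     = trans (sumMultiples-step n k (suc n) (pk k) (s≤s k≤n))
  (cong (λ y → pk k (suc n) + y) (sumMultiples-fuel n (n ∸ k) k (n ∸ k) (pk k) (ℕP.m∸n≤m n k) ℕP.≤-refl))

pk-stable : ∀ d n → pk (d + n) n ≡ pk n n
pk-stable zero    n = refl
pk-stable (suc d) n = trans (pk-small (d + n) n (s≤s (ℕP.m≤n+m n d))) (pk-stable d n)

parts∤4 : ℕ → List ℕ
parts∤4 zero    = []
parts∤4 (suc k) with 4 ∣? suc k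
... | yes _ = parts∤4 k
... | no  _ = suc k ∷ parts∤4 k

parts∤4-positive : ∀ k → All (0 <_) (parts∤4 k)
parts∤4-positive zero    = []
parts∤4-positive (suc k) with 4 ∣? suc k
... | yes _ = parts∤4-positive k
... | no  _ = s≤s z≤n ∷ parts∤4-positive k

pkSeries : ℕ → Series
pkSeries k (+ n)    = parity (pk k n)
pkSeries k -[1+ _ ] = 0ℙ

pkSeries-isPowerSeries : ∀ k → IsPowerSeries (pkSeries k)
pkSeries-isPowerSeries k = mkPowerSeries λ _ → refl

1+q^-pkSeries : ∀ k → ¬ 4 ∣ suc k → 1+q^ suc k · pkSeries (suc k) ≈ pkSeries k
1+q^-pkSeries k 4∤1+k = mk≈ coeff
  where
  coeff : ∀ x → (1+q^ suc k · pkSeries (suc k)) x ≡ pkSeries k x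
  coeff -[1+ m ] = coeff-sub-neg (pkSeries-isPowerSeries (suc k)) m (suc k)
  coeff (+ n) with suc k ≤? n
  ... | yes k<n = begin
    parity (pk (suc k) n) ⊕ pkSeries (suc k) (+ n -ᶻ + suc k)
      ≡⟨ cong₂ _⊕_ (cong parity (pk-step k n 4∤1+k k<n)) (coeff-sub-≥ (pkSeries (suc k)) k<n) ⟩
    parity (pk k n + pk (suc k) (n ∸ suc k)) ⊕ parity (pk (suc k) (n ∸ suc k))
      ≡⟨ cong (_⊕ parity (pk (suc k) (n ∸ suc k))) (ℙP.+-homo-+ (pk k n) _) ⟩
    (parity (pk k n) ⊕ parity (pk (suc k) (n ∸ suc k))) ⊕ parity (pk (suc k) (n ∸ suc k))
      ≡⟨ ⊕-cancelʳ (parity (pk k n)) _ ⟩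
    parity (pk k n) ∎
    where open ≡-Reasoning
  ... | no k≮n = trans (cong₂ _⊕_ (cong parity (pk-small k n (ℕP.≰⇒> k≮n)))
                                 (coeff-sub-< (pkSeries-isPowerSeries (suc k)) (ℕP.≰⇒> k≮n)))
                      (ℙP.+-identityʳ _)

pkSeries-∣4 : ∀ k → 4 ∣ suc k → pkSeries (suc k) ≈ pkSeries k
pkSeries-∣4 k 4∣1+k = mk≈ λ where
  (+ n)    → cong parity (pk-∣4 k n 4∣1+k)
  -[1+ _ ] → refl

-- ∏_{j ≤ k, 4 ∤ j} (1 + qʲ) inverts the generating function of pk k, since 1/(1 - qʲ) ≡ 1/(1 + qʲ) mod 2.
∏-parts∤4-pkSeries : ∀ k → ∏1+q^ parts∤4 k · pkSeries k ≈ one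
∏-parts∤4-pkSeries zero = mk≈ λ where
  (+ zero)  → refl
  (+ suc _) → refl
  -[1+ _ ]  → refl
∏-parts∤4-pkSeries (suc k) with 4 ∣? suc k
... | yes 4∣1+k = ≈-trans (∏-cong (parts∤4 k) (pkSeries-∣4 k 4∣1+k)) (∏-parts∤4-pkSeries k)
... | no  4∤1+k = begin
  1+q^ suc k · ∏1+q^ parts∤4 k · pkSeries (suc k)   ≈⟨ 1+q^-∏ (suc k) (parts∤4 k) (pkSeries (suc k)) ⟩
  ∏1+q^ parts∤4 k · 1+q^ suc k · pkSeries (suc k)   ≈⟨ ∏-cong (parts∤4 k) (1+q^-pkSeries k 4∤1+k) ⟩
  ∏1+q^ parts∤4 k · pkSeries k                      ≈⟨ ∏-parts∤4-pkSeries k ⟩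
  one                                               ∎
  where open ≈-Reasoning

private
  parts∤4-skip : ∀ k → 4 ∣ suc k → parts∤4 (suc k) ≡ parts∤4 k
  parts∤4-skip k 4∣1+k with 4 ∣? suc k
  ... | yes _     = refl
  ... | no 4∤1+k = ⊥-elim (4∤1+k 4∣1+k)

  parts∤4-keep : ∀ k → ¬ 4 ∣ suc k → parts∤4 (suc k) ≡ suc k ∷ parts∤4 k
  parts∤4-keep k 4∤1+k with 4 ∣? suc k
  ... | yes 4∣1+k = ⊥-elim (4∤1+k 4∣1+k)
  ... | no _      = refl

  4∤r+4N : ∀ r N → suc r < 4 → ¬ 4 ∣ suc r + N * 4
  4∤r+4N r N r<3 4∣ = ℕP.<⇒≱ r<3 (∣⇒≤ (∣m+n∣m⇒∣n (subst (4 ∣_) (ℕP.+-comm (suc r) (N * 4)) 4∣) (n∣m*n N)))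

parts∤4-block : ∀ N → parts∤4 (suc N * 4) ≡ (3 + N * 4) ∷ (2 + N * 4) ∷ (1 + N * 4) ∷ parts∤4 (N * 4)
parts∤4-block N =
  trans (parts∤4-skip (3 + N * 4) (n∣m*n (suc N)))
  (trans (parts∤4-keep (2 + N * 4) (4∤r+4N 2 N ℕP.≤-refl))
  (cong ((3 + N * 4) ∷_) (trans (parts∤4-keep (1 + N * 4) (4∤r+4N 1 N (s≤s (s≤s (s≤s z≤n)))))
  (cong ((2 + N * 4) ∷_) (parts∤4-keep (N * 4) (4∤r+4N 0 N (s≤s (s≤s z≤n))))))))

∏-parts∤4 : ∀ N f → ∏1+q^ parts∤4 (N * 4) · f
                  ≈ ∏1+q^ progression 3 N · ∏1+q^ progression 1 N · ∏1+q^ progression 2 N · f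
∏-parts∤4 zero    f = ≈-refl
∏-parts∤4 (suc N) f = begin
  ∏1+q^ parts∤4 (suc N * 4) · f
    ≡⟨ cong (λ l → ∏1+q^ l · f) (parts∤4-block N) ⟩
  1+q^ a · 1+q^ b · 1+q^ c · ∏1+q^ parts∤4 (N * 4) · f
    ≈⟨ 1+q^-cong a (1+q^-cong b (1+q^-cong c (∏-parts∤4 N f))) ⟩
  1+q^ a · 1+q^ b · 1+q^ c · P₃· P₁· P₂· f
    ≈⟨ 1+q^-cong a (1+q^-comm b c (P₃· P₁· P₂· f)) ⟩
  1+q^ a · 1+q^ c · 1+q^ b · P₃· P₁· P₂· f
    ≈⟨ 1+q^-cong a (1+q^-cong c (1+q^-∏ b (progression 3 N) (P₁· P₂· f))) ⟩
  1+q^ a · 1+q^ c · P₃· 1+q^ b · P₁· P₂· f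
    ≈⟨ 1+q^-cong a (1+q^-cong c (∏-cong (progression 3 N) (1+q^-∏ b (progression 1 N) (P₂· f)))) ⟩
  1+q^ a · 1+q^ c · P₃· P₁· 1+q^ b · P₂· f
    ≈⟨ 1+q^-cong a (1+q^-∏ c (progression 3 N) (P₁· 1+q^ b · P₂· f)) ⟩
  1+q^ a · P₃· 1+q^ c · P₁· 1+q^ b · P₂· f ∎
  where
  open ≈-Reasoning
  a = 3 + N * 4
  b = 2 + N * 4
  c = 1 + N * 4
  infixr 5 P₁·_ P₂·_ P₃·_
  P₁·_ P₂·_ P₃·_ : Series → Series
  P₁· g = ∏1+q^ progression 1 N · g
  P₂· g = ∏1+q^ progression 2 N · g
  P₃· g = ∏1+q^ progression 3 N · g

-- Since ∏_{4 ∤ j} = ∏_{j odd} ∏_{j ≡ 2 (4)} and ∏_{j odd}² = ∏_{j ≡ 2 (4)}, multiplying Gauss's identity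
-- by ∏_{4 ∤ j} gives ∏_{j odd} = ∏_{j odd} ∏_{4 ∤ j} θ; cancel, and compare with ∏-parts∤4-pkSeries.
θ·one≈[]pkSeries : ∀ L → θ· one ≈[ L ] pkSeries (suc (L + L) * 4)
θ·one≈[]pkSeries L =
  ∏-cancel (parts∤4 (N * 4)) (parts∤4-positive (N * 4)) (θ-isPowerSeries one-isPowerSeries) (pkSeries-isPowerSeries _)
    (≈[]-trans (≈[]-sym one≈D·θ·one) (≈⇒≈[] (≈-sym (∏-parts∤4-pkSeries (N * 4)))))
  where
  N = suc (L + L)
  infixr 5 P₁·_ P₂·_ P₃·_ D·_
  P₁·_ P₂·_ P₃·_ D·_ : Series → Series
  P₁· g = ∏1+q^ progression 1 N · g
  P₂· g = ∏1+q^ progression 2 N · g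
  P₃· g = ∏1+q^ progression 3 N · g
  D·  g = ∏1+q^ parts∤4 (N * 4) · g

  ps : ∀ l {f} → IsPowerSeries f → IsPowerSeries (∏1+q^ l · f)
  ps = ∏-isPowerSeries

  odd·D·one≈[]P₂·P₂·one : P₃· P₁· D· one ≈[ L ] P₂· P₂· one
  odd·D·one≈[]P₂·P₂·one = begin
    P₃· P₁· D· one
      ≈⟨ ≈⇒≈[] (∏-cong (progression 3 N) (∏-cong (progression 1 N) (∏-parts∤4 N one))) ⟩
    P₃· P₁· P₃· P₁· P₂· one
      ≈⟨ ≈⇒≈[] (∏-odd-square N (P₂· one)) ⟩
    ∏1+q^ progression 2 (N * 2) · P₂· one
      ≈⟨ ∏-progression-high (ps (progression 2 N) one-isPowerSeries) L<2+4N (ℕP.m≤m*n N 2) ⟩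
    P₂· P₂· one ∎
    where
    open ≈[]-Reasoning L
    L<2+4N : L < 2 + N * 4
    L<2+4N = ℕP.<-≤-trans (s≤s (ℕP.m≤m+n L L)) (ℕP.≤-trans (ℕP.m≤m*n N 4) (ℕP.m≤n+m _ 2))

  θ-commutes : θ· P₃· P₁· D· one ≈ P₃· P₁· D· θ· one
  θ-commutes = ≈-trans (θ-∏ (progression 3 N) (ps (progression 1 N) (ps (parts∤4 (N * 4)) one-isPowerSeries)))
    (∏-cong (progression 3 N) (≈-trans (θ-∏ (progression 1 N) (ps (parts∤4 (N * 4)) one-isPowerSeries))
      (∏-cong (progression 1 N) (θ-∏ (parts∤4 (N * 4)) one-isPowerSeries))))

  odd·one≈[]odd·D·θ·one : P₃· P₁· one ≈[ L ] P₃· P₁· D· θ· one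
  odd·one≈[]odd·D·θ·one = begin
    P₃· P₁· one               ≈⟨ odd-product≈θ·twice-even-product L ⟩
    θ· P₂· P₂· one            ≈⟨ θ-cong-≈[] (ps (progression 2 N) (ps (progression 2 N) one-isPowerSeries))
                                         (ps (progression 3 N) (ps (progression 1 N) (ps (parts∤4 (N * 4)) one-isPowerSeries)))
                                         (≈[]-sym odd·D·one≈[]P₂·P₂·one) ⟩
    θ· P₃· P₁· D· one         ≈⟨ ≈⇒≈[] θ-commutes ⟩
    P₃· P₁· D· θ· one         ∎
    where open ≈[]-Reasoning L

  one≈D·θ·one : one ≈[ L ] D· θ· one
  one≈D·θ·one =
    ∏-cancel (progression 1 N) (progression-positive (s≤s z≤n) N) one-isPowerSeries Dθ-ps
      (∏-cancel (progression 3 N) (progression-positive (s≤s z≤n) N)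
        (ps (progression 1 N) one-isPowerSeries) (ps (progression 1 N) Dθ-ps) odd·one≈[]odd·D·θ·one)
    where
    Dθ-ps : IsPowerSeries (D· θ· one)
    Dθ-ps = ps (parts∤4 (N * 4)) (θ-isPowerSeries one-isPowerSeries)

θ·one≡parity-b₄ : ∀ n → (θ· one) (+ n) ≡ parity (b₄ n)
θ·one≡parity-b₄ n = begin
  (θ· one) (+ n)              ≡⟨ coeff-≈[] (θ·one≈[]pkSeries n) n ℕP.≤-refl ⟩
  parity (pk (N * 4) n)       ≡⟨ cong (λ k → parity (pk k n)) (ℕP.m∸n+n≡m n≤4N) ⟨
  parity (pk (N * 4 ∸ n + n) n) ≡⟨ cong parity (pk-stable (N * 4 ∸ n) n) ⟩
  parity (b₄ n)               ∎
  where
  open ≡-Reasoning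
  N = suc (n + n)
  n≤4N : n ≤ N * 4
  n≤4N = ℕP.≤-trans (ℕP.m≤m+n n n) (ℕP.≤-trans (ℕP.n≤1+n _) (ℕP.m≤m*n N 4))

8tri+1≡square : ∀ k → ∃[ s ] 8 * tri k + 1 ≡ s * s
8tri+1≡square (+ n)    = 1 + 4 * n , square n
  where
  square : ∀ n → 8 * (n * (1 + 2 * n)) + 1 ≡ (1 + 4 * n) * (1 + 4 * n)
  square = ℕSolver.solve-∀
8tri+1≡square -[1+ m ] = 3 + 4 * m , square m
  where
  square : ∀ m → 8 * (suc m * (1 + 2 * m)) + 1 ≡ (3 + 4 * m) * (3 + 4 * m)
  square = ℕSolver.solve-∀

b₄-odd⇒8n+1-square : ∀ n → parity (b₄ n) ≡ 1ℙ → ∃[ s ] 8 * n + 1 ≡ s * s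
b₄-odd⇒8n+1-square n odd =
  let k , n≡tri = θ·one≡1ℙ⇒triangular n (trans (θ·one≡parity-b₄ n) odd)
  in subst (λ t → ∃[ s ] 8 * t + 1 ≡ s * s) (sym n≡tri) (8tri+1≡square k)

exact-divisor⇒non-square : ∀ {p x} s → Prime p → p ∣ x → ¬ (p ^ 2 ∣ x) → x ≢ s * s
exact-divisor⇒non-square {p} s pp p∣x p²∤x x≡s² = p²∤x (subst (p ^ 2 ∣_) (sym x≡s²) p²∣s²)
  where
  p∣s : p ∣ s
  p∣s = [ id , id ] (euclidsLemma s s pp (subst (p ∣_) x≡s² p∣x))
  p²∣s² : p ^ 2 ∣ s * s
  p²∣s² = subst (_∣ s * s) (cong (p *_) (sym (ℕP.*-identityʳ p))) (*-pres-∣ p∣s p∣s)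

parity≡0ℙ⇒%2≡0 : ∀ n → parity n ≡ 0ℙ → n % 2 ≡ 0
parity≡0ℙ⇒%2≡0 zero          _    = refl
parity≡0ℙ⇒%2≡0 (suc (suc n)) even = parity≡0ℙ⇒%2≡0 n even

parity≢1ℙ⇒≡0ℙ : ∀ n → parity n ≢ 1ℙ → parity n ≡ 0ℙ
parity≢1ℙ⇒≡0ℙ n ¬odd with parity n
... | 0ℙ = refl
... | 1ℙ = ⊥-elim (¬odd refl)

proposition4p3 : (m j : ℕ) → Prime m → ¬ (2 ∣ m) → m ∣ 8 * j + 1 → ¬ (m ^ 2 ∣ 8 * j + 1) →
                   (n : ℕ) → b₄ (m ^ 2 * n + j) % 2 ≡ 0
proposition4p3 m j m-prime _ m∣8j+1 m²∤8j+1 n =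
  parity≡0ℙ⇒%2≡0 (b₄ N) (parity≢1ℙ⇒≡0ℙ (b₄ N) λ odd →
    let s , 8N+1≡s² = b₄-odd⇒8n+1-square N odd
    in exact-divisor⇒non-square s m-prime m∣8N+1 m²∤8N+1 8N+1≡s²)
  where
  N = m ^ 2 * n + j
  split : 8 * N + 1 ≡ 8 * (m ^ 2 * n) + (8 * j + 1)
  split = distrib (m ^ 2 * n) j
    where
    distrib : ∀ a j → 8 * (a + j) + 1 ≡ 8 * a + (8 * j + 1)
    distrib = ℕSolver.solve-∀
  m²∣8m²n : m ^ 2 ∣ 8 * (m ^ 2 * n)
  m²∣8m²n = ∣-trans (m∣m*n n) (n∣m*n 8)
  m∣8N+1 : m ∣ 8 * N + 1
  m∣8N+1 = subst (m ∣_) (sym split) (∣m∣n⇒∣m+n (∣-trans (m∣m*n (m * 1)) m²∣8m²n) m∣8j+1)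
  m²∤8N+1 : ¬ (m ^ 2 ∣ 8 * N + 1)
  m²∤8N+1 m²∣8N+1 = m²∤8j+1 (∣m+n∣m⇒∣n (subst (m ^ 2 ∣_) split m²∣8N+1) m²∣8m²n)
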